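{- For every integer $n\geq0$, $$\sum_{k=0}^{n}(-1)^{k}{2n+1\brack 2k}(-q;q)_{2n-2k}\,\widetilde T_{2k+1}(q)=(-1)^nT_{2n+1}(q),$$ where $\widetilde T_{1}(q)=1$ and, for $k\geq1$, $$\widetilde T_{2k+1}(q)=\sum_{i=0}^{k-1} {2k\brack 2i+1} T_{2i + 1}(q)\, T_{2k - 2i - 1}(q).$$
   Context: For a nonnegative integer $m$, $(t;q)_m=\prod_{i=0}^{m-1}(1-tq^i)$; in particular $(-q;q)_m=(1+q)(1+q^2)\cdots(1+q^m)$. The $q$-binomial coefficient is ${m\brack j}=\frac{(q;q)_m}{(q;q)_{m-j}(q;q)_j}$ for $0\le j\le m$. The $q$-sine and $q$-cosine are $\sin_q(x)=\sum_{m\geq0}(-1)^m\frac{x^{2m+1}}{(q;q)_{2m+1}}$ and $\cos_q(x)=\sum_{m\geq0}(-1)^m\frac{x^{2m}}{(q;q)_{2m}}$, and the $q$-tangent numbers $T_{2m+1}(q)$ are defined by $\frac{\sin_q(x)}{\cos_q(x)}=\sum_{m\geq0}T_{2m+1}(q)\frac{x^{2m+1}}{(q;q)_{2m+1}}$. (Equivalently, $T_{2m+1}(q)=\sum_{\pi}q^{\mathsf{inv}(\pi)}$ over down-up permutations $\pi_1>\pi_2<\pi_3>\cdots$ of $[2m+1]$, where $\mathsf{inv}$ is the number of inversions.) -}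

module Defs where

open import Data.Nat as ℕ using (ℕ; zero; suc; _∸_; _≤ᵇ_; _<ᵇ_)
open import Data.Integer as ℤ using (ℤ; +_; -_; _^_) renaming (_+_ to _+ℤ_; _*_ to _*ℤ_)
open import Data.Bool using (Bool; true; false; if_then_else_; _∧_)
open import Data.List using (List; []; _∷_; map; concatMap; filter; length; upTo; foldr)
open import Function using (_∘_)
open import Relation.Nullary.Decidable using (does)
open import Relation.Binary.PropositionalEquality using (_≡_)

-- Formal power series in q with integer coefficients: ℤ[[q]] ⊇ ℤ[q].
-- A series is its coefficient sequence; equality is coefficientwise.

PS : Set
PS = ℕ → ℤ

_≈PS_ : PS → PS → Set
f ≈PS g = ∀ d → f d ≡ g d

0PS : PS
0PS _ = + 0

1PS : PS
1PS zero = + 1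
1PS (suc _) = + 0

qpow : ℕ → PS
qpow k d = if (k ℕ.≡ᵇ d) then + 1 else + 0

const : ℤ → PS
const c zero = c
const c (suc _) = + 0

_⊕_ : PS → PS → PS
(f ⊕ g) d = f d +ℤ g d

⊖_ : PS → PS
(⊖ f) d = - f d

sumℤ : ℕ → (ℕ → ℤ) → ℤ
sumℤ zero h = + 0
sumℤ (suc n) h = sumℤ n h +ℤ h n

_⊗_ : PS → PS → PS
(f ⊗ g) d = sumℤ (suc d) (λ i → f i *ℤ g (d ∸ i))

infixl 7 _⊗_
infixl 6 _⊕_

sumPS : ℕ → (ℕ → PS) → PS
sumPS n F d = sumℤ n (λ k → F k d)

prodPS : ℕ → (ℕ → PS) → PS
prodPS zero F = 1PS
prodPS (suc n) F = prodPS n F ⊗ F n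

-- Multiplicative inverse of a series f with constant term 1:
-- g 0 = 1,  g k = - Σ_{i=1}^{k} f i * g (k - i).
-- invUpTo f n gives the correct coefficients at all indices ≤ n.
invUpTo : PS → ℕ → PS
invUpTo f zero = 1PS
invUpTo f (suc n) k =
  if k ℕ.≤ᵇ n then invUpTo f n k
  else - sumℤ k (λ j → f (suc j) *ℤ invUpTo f n (k ∸ suc j))

inv : PS → PS
inv f k = invUpTo f k k

qPoch : ℕ → PS
qPoch m = prodPS m (λ i → 1PS ⊕ ⊖ qpow (suc i))

negqPoch : ℕ → PS
negqPoch m = prodPS m (λ i → 1PS ⊕ qpow (suc i))

-- q-binomial [m j] = (q;q)_m / ((q;q)_{m-j} (q;q)_j)   (used for 0 ≤ j ≤ m)
qbin : ℕ → ℕ → PS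
qbin m j = qPoch m ⊗ inv (qPoch (m ∸ j) ⊗ qPoch j)

insertAll : ℕ → List ℕ → List (List ℕ)
insertAll x [] = (x ∷ []) ∷ []
insertAll x (y ∷ ys) = (x ∷ y ∷ ys) ∷ map (y ∷_) (insertAll x ys)

perms : List ℕ → List (List ℕ)
perms [] = [] ∷ []
perms (x ∷ xs) = concatMap (insertAll x) (perms xs)

-- alternating check; flag true means the next step must be a descent
altFrom : Bool → List ℕ → Bool
altFrom _ [] = true
altFrom _ (_ ∷ []) = true
altFrom true (x ∷ y ∷ r) = (y <ᵇ x) ∧ altFrom false (y ∷ r)
altFrom false (x ∷ y ∷ r) = (x <ᵇ y) ∧ altFrom true (y ∷ r)

downUp : List ℕ → Bool
downUp = altFrom true

invs : List ℕ → ℕ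
invs [] = 0
invs (x ∷ xs) = length (filter (λ y → y ℕ.<? x) xs) ℕ.+ invs xs

-- T n = Σ_{π down-up permutation of an n-element ordered set} q^{inv π}
-- (we use the ordered set {0,…,n-1}, order-isomorphic to [n]).
Tq : ℕ → PS
Tq n = foldr (λ π acc → qpow (invs π) ⊕ acc) 0PS
             (filter (λ π → downUp π Data.Bool.≟ true) (perms (upTo n)))
  where import Data.Bool

Ttilde : ℕ → PS
Ttilde zero = 1PS
Ttilde (suc k) =
  sumPS (suc k) (λ i → qbin (2 ℕ.* suc k) (2 ℕ.* i ℕ.+ 1)
                       ⊗ Tq (2 ℕ.* i ℕ.+ 1) ⊗ Tq (2 ℕ.* k ℕ.+ 1 ∸ 2 ℕ.* i))

sgn : ℕ → ℤ
sgn k = (- + 1) ^ k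

-- The q-tangent numbers count down-up permutations by inversions. The least entry of such a
-- permutation sits at an odd position 2j+1 (counting from 0) and splits it into two down-up blocks;
-- this gives D τ = 1 - τ(qx) τ(x) for τ = Σ (-1)^k T_{2k+1}(q) x^{2k+1}/(q;q)_{2k+1}, where D is
-- the q-derivative. With G = Σ (-q;q)_n xⁿ/(q;q)_n and ρ = (1 + x) G, the series τ (ρ + 1) - (ρ - 1)
-- and 4ρP - ρ² + 1, where P = Σ (-q;q)_{2j} x^{2j+1}/(q;q)_{2j+1}, solve linear q-difference
-- equations with zero constant term, hence vanish. Eliminating ρ gives (1 - τ²) P = τ. Since the
-- coefficient of x^{2k} in 1 - τ² is (-1)^k T̃_{2k+1}(q)/(q;q)_{2k}, the coefficient of x^{2n+1}
-- of this identity, multiplied by (q;q)_{2n+1}, is the theorem.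

module Submission where

open import Algebra
open import Algebra.Solver.Ring.AlmostCommutativeRing using (_-Raw-AlmostCommutative⟶_; fromCommutativeRing)
import Data.Integer.Properties

module Arithmetic where

  open import Data.Bool using (true; false)
  open import Data.Nat using (ℕ; zero; suc; _*_; _∸_; _≤_; _<_; s≤s; _<ᵇ_)
  open import Data.Nat.Properties using (*-suc)
  open import Relation.Binary.PropositionalEquality using (_≡_; refl; cong; trans; cong₂; subst)

  2*suc : ∀ k → 2 * suc k ≡ suc (suc (2 * k))
  2*suc k = *-suc 2 k

  data Parity : ℕ → Set where
    Even : ∀ k → Parity (2 * k)
    Odd : ∀ k → Parity (suc (2 * k))

  parity : ∀ n → Parity n
  parity zero = Even 0
  parity (suc n) with parity n
  ... | Even k = Odd k
  ... | Odd k = subst Parity (2*suc k) (Even (suc k))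

  2m∸[1+2j]≡1+2[m∸[1+j]] : ∀ {j m} → j < m → 2 * m ∸ suc (2 * j) ≡ suc (2 * (m ∸ suc j))
  2m∸[1+2j]≡1+2[m∸[1+j]] {zero} {suc m} _ = cong (_∸ 1) (2*suc m)
  2m∸[1+2j]≡1+2[m∸[1+j]] {suc j} {suc m} (s≤s j<m) =
    trans (cong₂ _∸_ (2*suc m) (cong suc (2*suc j))) (2m∸[1+2j]≡1+2[m∸[1+j]] j<m)

  1+2n∸2k≡1+2[n∸k] : ∀ {k n} → k ≤ n → suc (2 * n) ∸ 2 * k ≡ suc (2 * (n ∸ k))
  1+2n∸2k≡1+2[n∸k] {zero} _ = refl
  1+2n∸2k≡1+2[n∸k] {suc k} {suc n} (s≤s k≤n) =
    trans (cong₂ _∸_ (cong suc (2*suc n)) (2*suc k)) (1+2n∸2k≡1+2[n∸k] k≤n)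

  <⇒<ᵇ≡true : ∀ {m n} → m < n → (m <ᵇ n) ≡ true
  <⇒<ᵇ≡true {zero} {suc n} _ = refl
  <⇒<ᵇ≡true {suc m} {suc n} (s≤s m<n) = <⇒<ᵇ≡true m<n

  ≤⇒>ᵇ≡false : ∀ {m n} → m ≤ n → (n <ᵇ m) ≡ false
  ≤⇒>ᵇ≡false {zero} _ = refl
  ≤⇒>ᵇ≡false {suc m} {suc n} (s≤s m≤n) = ≤⇒>ᵇ≡false m≤n

module FiniteSums {c ℓ} (R : CommutativeRing c ℓ) where

  open import Data.Bool using (Bool; true; false)
  open import Data.List using (List; []; _∷_; _++_; map; concatMap)
  open import Data.List.Relation.Unary.All using (All; []; _∷_)
  open import Data.Nat using (ℕ; zero; suc; _∸_) renaming (_+_ to _+ℕ_; _*_ to _*ℕ_; _<_ to _<ℕ_)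
  import Data.Nat.Properties as ℕP
  open import Function using (_∘_)
  open import Relation.Binary.PropositionalEquality as ≡ using (_≡_)

  open Arithmetic using (2*suc)
  open CommutativeRing R renaming (Carrier to K) hiding (zero)
  open import Algebra.Properties.CommutativeSemigroup +-commutativeSemigroup using (interchange)
  open import Relation.Binary.Reasoning.Setoid setoid

  Σ : ℕ → (ℕ → K) → K
  Σ zero h = 0#
  Σ (suc n) h = Σ n h + h n

  Σ-cong : ∀ n {f g : ℕ → K} → (∀ i → i <ℕ n → f i ≈ g i) → Σ n f ≈ Σ n g
  Σ-cong zero eq = refl
  Σ-cong (suc n) eq = +-cong (Σ-cong n (λ i i<n → eq i (ℕP.m<n⇒m<1+n i<n))) (eq n ℕP.≤-refl)

  Σ-cong′ : ∀ n {f g : ℕ → K} → (∀ i → f i ≈ g i) → Σ n f ≈ Σ n g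
  Σ-cong′ n eq = Σ-cong n (λ i _ → eq i)

  Σ-zero : ∀ n {f : ℕ → K} → (∀ i → i <ℕ n → f i ≈ 0#) → Σ n f ≈ 0#
  Σ-zero zero eq = refl
  Σ-zero (suc n) eq = trans (+-cong (Σ-zero n (λ i i<n → eq i (ℕP.m<n⇒m<1+n i<n))) (eq n ℕP.≤-refl)) (+-identityˡ 0#)

  Σ-distrib-+ : ∀ n (f g : ℕ → K) → Σ n (λ i → f i + g i) ≈ Σ n f + Σ n g
  Σ-distrib-+ zero f g = sym (+-identityˡ 0#)
  Σ-distrib-+ (suc n) f g = begin
    Σ n (λ i → f i + g i) + (f n + g n) ≈⟨ +-congʳ (Σ-distrib-+ n f g) ⟩
    (Σ n f + Σ n g) + (f n + g n)       ≈⟨ interchange _ _ _ _ ⟩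
    (Σ n f + f n) + (Σ n g + g n)       ∎

  *-distribˡ-Σ : ∀ n a (f : ℕ → K) → a * Σ n f ≈ Σ n (λ i → a * f i)
  *-distribˡ-Σ zero a f = zeroʳ a
  *-distribˡ-Σ (suc n) a f = trans (distribˡ a _ _) (+-congʳ (*-distribˡ-Σ n a f))

  *-distribʳ-Σ : ∀ n a (f : ℕ → K) → Σ n f * a ≈ Σ n (λ i → f i * a)
  *-distribʳ-Σ n a f = trans (*-comm _ _) (trans (*-distribˡ-Σ n a f) (Σ-cong′ n (λ i → *-comm _ _)))

  Σ-head : ∀ n (h : ℕ → K) → Σ (suc n) h ≈ h 0 + Σ n (h ∘ suc)
  Σ-head zero h = trans (+-identityˡ _) (sym (+-identityʳ _))
  Σ-head (suc n) h = trans (+-congʳ (Σ-head n h)) (+-assoc _ _ _)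

  Σ-reverse : ∀ n (h : ℕ → K) → Σ n h ≈ Σ n (λ i → h (n ∸ suc i))
  Σ-reverse zero h = refl
  Σ-reverse (suc n) h = begin
    Σ n h + h n                            ≈⟨ +-comm _ _ ⟩
    h n + Σ n h                            ≈⟨ +-congˡ (Σ-reverse n h) ⟩
    h n + Σ n (λ i → h (n ∸ suc i))        ≈⟨ Σ-head n (λ i → h (n ∸ i)) ⟨
    Σ (suc n) (λ i → h (n ∸ i))            ∎

  Σ-+-split : ∀ m n (h : ℕ → K) → Σ (m +ℕ n) h ≈ Σ m h + Σ n (λ i → h (m +ℕ i))
  Σ-+-split m zero h = trans (reflexive (≡.cong (λ k → Σ k h) (ℕP.+-identityʳ m))) (sym (+-identityʳ _))
  Σ-+-split m (suc n) h = begin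
    Σ (m +ℕ suc n) h                               ≈⟨ reflexive (≡.cong (λ k → Σ k h) (ℕP.+-suc m n)) ⟩
    Σ (m +ℕ n) h + h (m +ℕ n)                      ≈⟨ +-congʳ (Σ-+-split m n h) ⟩
    (Σ m h + Σ n (λ i → h (m +ℕ i))) + h (m +ℕ n)  ≈⟨ +-assoc _ _ _ ⟩
    Σ m h + Σ (suc n) (λ i → h (m +ℕ i))           ∎

  Σ-triangle : ∀ N (F : ℕ → ℕ → K) →
    Σ N (λ i → Σ (N ∸ i) (F i)) ≈ Σ N (λ m → Σ (suc m) (λ i → F i (m ∸ i)))
  Σ-triangle zero F = refl
  Σ-triangle (suc N) F = begin
    Σ (suc N) (λ i → Σ (suc N ∸ i) (F i))
      ≈⟨ Σ-cong (suc N) (λ i i≤N → reflexive (≡.cong (λ k → Σ k (F i)) (ℕP.+-∸-assoc 1 (ℕP.≤-pred i≤N)))) ⟩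
    Σ (suc N) (λ i → Σ (N ∸ i) (F i) + F i (N ∸ i))
      ≈⟨ Σ-distrib-+ (suc N) _ _ ⟩
    (Σ N (λ i → Σ (N ∸ i) (F i)) + Σ (N ∸ N) (F N)) + Σ (suc N) (λ i → F i (N ∸ i))
      ≈⟨ +-congʳ (+-cong (Σ-triangle N F) (reflexive (≡.cong (λ k → Σ k (F N)) (ℕP.n∸n≡0 N)))) ⟩
    (Σ N (λ m → Σ (suc m) (λ i → F i (m ∸ i))) + 0#) + Σ (suc N) (λ i → F i (N ∸ i))
      ≈⟨ +-congʳ (+-identityʳ _) ⟩
    Σ (suc N) (λ m → Σ (suc m) (λ i → F i (m ∸ i))) ∎

  Σ-even-odd : ∀ m (h : ℕ → K) → Σ (2 *ℕ m) h ≈ Σ m (λ j → h (2 *ℕ j) + h (suc (2 *ℕ j)))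
  Σ-even-odd zero h = refl
  Σ-even-odd (suc m) h = begin
    Σ (2 *ℕ suc m) h                                        ≈⟨ reflexive (≡.cong (λ k → Σ k h) (2*suc m)) ⟩
    (Σ (2 *ℕ m) h + h (2 *ℕ m)) + h (suc (2 *ℕ m))          ≈⟨ +-assoc _ _ _ ⟩
    Σ (2 *ℕ m) h + (h (2 *ℕ m) + h (suc (2 *ℕ m)))          ≈⟨ +-congʳ (Σ-even-odd m h) ⟩
    Σ (suc m) (λ j → h (2 *ℕ j) + h (suc (2 *ℕ j)))         ∎

  ΣL : ∀ {a} {A : Set a} → (A → K) → List A → K
  ΣL f [] = 0#
  ΣL f (x ∷ xs) = f x + ΣL f xs

  ΣL-cong : ∀ {a} {A : Set a} {f g : A → K} {xs} → All (λ x → f x ≈ g x) xs → ΣL f xs ≈ ΣL g xs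
  ΣL-cong [] = refl
  ΣL-cong (e ∷ es) = +-cong e (ΣL-cong es)

  ΣL-cong′ : ∀ {a} {A : Set a} {f g : A → K} xs → (∀ x → f x ≈ g x) → ΣL f xs ≈ ΣL g xs
  ΣL-cong′ [] e = refl
  ΣL-cong′ (x ∷ xs) e = +-cong (e x) (ΣL-cong′ xs e)

  ΣL-++ : ∀ {a} {A : Set a} (f : A → K) xs ys → ΣL f (xs ++ ys) ≈ ΣL f xs + ΣL f ys
  ΣL-++ f [] ys = sym (+-identityˡ (ΣL f ys))
  ΣL-++ f (x ∷ xs) ys = trans (+-congˡ (ΣL-++ f xs ys)) (sym (+-assoc (f x) (ΣL f xs) (ΣL f ys)))

  ΣL-map : ∀ {a b} {A : Set a} {B : Set b} (f : B → K) (g : A → B) xs → ΣL f (map g xs) ≡ ΣL (f ∘ g) xs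
  ΣL-map f g [] = ≡.refl
  ΣL-map f g (x ∷ xs) = ≡.cong (f (g x) +_) (ΣL-map f g xs)

  ΣL-concatMap : ∀ {a b} {A : Set a} {B : Set b} (f : B → K) (h : A → List B) xs →
    ΣL f (concatMap h xs) ≈ ΣL (λ x → ΣL f (h x)) xs
  ΣL-concatMap f h [] = refl
  ΣL-concatMap f h (x ∷ xs) = trans (ΣL-++ f (h x) (concatMap h xs)) (+-congˡ (ΣL-concatMap f h xs))

  ΣL-Σ-comm : ∀ {a} {A : Set a} n (F : ℕ → A → K) xs → ΣL (λ x → Σ n (λ i → F i x)) xs ≈ Σ n (λ i → ΣL (F i) xs)
  ΣL-Σ-comm n F [] = sym (Σ-zero n (λ _ _ → refl))
  ΣL-Σ-comm n F (x ∷ xs) = trans (+-congˡ (ΣL-Σ-comm n F xs)) (sym (Σ-distrib-+ n (λ i → F i x) (λ i → ΣL (F i) xs)))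

  *-distribˡ-ΣL : ∀ {a} {A : Set a} r (f : A → K) xs → r * ΣL f xs ≈ ΣL (λ x → r * f x) xs
  *-distribˡ-ΣL r f [] = zeroʳ r
  *-distribˡ-ΣL r f (x ∷ xs) = trans (distribˡ r (f x) (ΣL f xs)) (+-congˡ (*-distribˡ-ΣL r f xs))

  infix 8 [_]·_
  [_]·_ : Bool → K → K
  [ true ]· x = x
  [ false ]· x = 0#

  []·-cong : ∀ b {x y} → x ≈ y → [ b ]· x ≈ [ b ]· y
  []·-cong true e = e
  []·-cong false e = refl

  ΣL-[]· : ∀ {a} {A : Set a} b (f : A → K) xs → ΣL (λ x → [ b ]· f x) xs ≈ [ b ]· ΣL f xs
  ΣL-[]· true f xs = refl
  ΣL-[]· false f [] = refl
  ΣL-[]· false f (x ∷ xs) = trans (+-identityˡ _) (ΣL-[]· false f xs)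

  []·-*ˡ : ∀ b x y → [ b ]· (x * y) ≈ x * [ b ]· y
  []·-*ˡ true x y = refl
  []·-*ˡ false x y = sym (zeroʳ x)

module RingSolver {c ℓ} (R : CommutativeRing c ℓ)
  (ι : CommutativeRing.rawRing Data.Integer.Properties.+-*-commutativeRing -Raw-AlmostCommutative⟶ fromCommutativeRing R) where

  import Data.Integer.Properties as ℤP
  open import Data.Integer as ℤ using (ℤ)
  open import Data.Maybe as Maybe using (Maybe)
  open import Function using (_∘_)
  open import Relation.Binary.PropositionalEquality using (cong)
  open import Relation.Nullary.Decidable using (dec⇒maybe)
  import Algebra.Solver.Ring

  open CommutativeRing R using (_≈_; reflexive)
  open _-Raw-AlmostCommutative⟶_ ι using (⟦_⟧)

  private
    coefficient-≈? : (a b : ℤ) → Maybe (⟦ a ⟧ ≈ ⟦ b ⟧)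
    coefficient-≈? a b = Maybe.map (reflexive ∘ cong ⟦_⟧) (dec⇒maybe (a ℤ.≟ b))

  open Algebra.Solver.Ring (CommutativeRing.rawRing ℤP.+-*-commutativeRing) (fromCommutativeRing R) ι coefficient-≈? public
    using (solve; _:=_; _:+_; _:*_; :-_; _:-_; con)

module PowerSeries {c ℓ} (R : CommutativeRing c ℓ)
  (ι : CommutativeRing.rawRing Data.Integer.Properties.+-*-commutativeRing -Raw-AlmostCommutative⟶ fromCommutativeRing R) where

  import Data.Integer.Properties as ℤP
  open import Data.Integer using (ℤ; +_)
  open import Data.Nat using (ℕ; zero; suc; _∸_; s≤s) renaming (_+_ to _+ℕ_; _*_ to _*ℕ_; _≤_ to _≤ℕ_; _<_ to _<ℕ_)
  open import Data.Nat.Induction using (<-rec)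
  import Data.Nat.Properties as ℕP
  open import Data.Product using (_,_)
  open import Function using (_∘_)
  open import Relation.Binary.PropositionalEquality as ≡ using (_≡_)

  open Arithmetic
  open FiniteSums R
  open RingSolver R ι using (solve; _:=_; _:+_; _:*_; _:-_; con)
  open CommutativeRing R renaming (Carrier to K) hiding (zero)
  open import Algebra.Properties.Ring ring using (-0#≈0#; -‿distribʳ-*)
  import Algebra.Properties.Ring
  open import Relation.Binary.Reasoning.Setoid setoid
  open _-Raw-AlmostCommutative⟶_ ι using (⟦_⟧)
  open _-Raw-AlmostCommutative⟶_ ι using (1-homo)

  Series : Set c
  Series = ℕ → K

  infix 4 _≐_ _≈ₛ_
  infixl 6 _+ₛ_
  infixl 7 _*ₛ_
  infix 8 -ₛ_

  _≐_ : Series → Series → Set ℓ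
  f ≐ g = ∀ n → f n ≈ g n

  -- A record rather than the bare Π-type, so that f and g can be inferred from a proof of f ≈ₛ g.
  record _≈ₛ_ (f g : Series) : Set ℓ where
    constructor pw
    field at : f ≐ g
  open _≈ₛ_ public

  _+ₛ_ : Series → Series → Series
  (f +ₛ g) n = f n + g n

  -ₛ_ : Series → Series
  (-ₛ f) n = - f n

  0ₛ : Series
  0ₛ _ = 0#

  constₛ : ℤ → Series
  constₛ k zero = ⟦ k ⟧
  constₛ k (suc _) = 0#

  1ₛ : Series
  1ₛ = constₛ (+ 1)

  _*ₛ_ : Series → Series → Series
  (f *ₛ g) n = Σ (suc n) (λ i → f i * g (n ∸ i))

  X : Series
  X zero = 0#
  X (suc zero) = 1#
  X (suc (suc _)) = 0#

  *ₛ-cong : ∀ {f f′ g g′} → f ≐ f′ → g ≐ g′ → f *ₛ g ≐ f′ *ₛ g′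
  *ₛ-cong ef eg n = Σ-cong′ (suc n) (λ i → *-cong (ef i) (eg (n ∸ i)))

  *ₛ-comm : ∀ f g → f *ₛ g ≐ g *ₛ f
  *ₛ-comm f g n = begin
    Σ (suc n) (λ i → f i * g (n ∸ i))                 ≈⟨ Σ-reverse (suc n) _ ⟩
    Σ (suc n) (λ i → f (n ∸ i) * g (n ∸ (n ∸ i)))
      ≈⟨ Σ-cong (suc n) (λ i i≤n → trans (*-comm _ _) (*-congʳ (reflexive (≡.cong g (ℕP.m∸[m∸n]≡n (ℕP.≤-pred i≤n)))))) ⟩
    Σ (suc n) (λ i → g i * f (n ∸ i))                 ∎

  *ₛ-assoc : ∀ f g h → (f *ₛ g) *ₛ h ≐ f *ₛ (g *ₛ h)
  *ₛ-assoc f g h n = begin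
    Σ (suc n) (λ m → Σ (suc m) (λ i → f i * g (m ∸ i)) * h (n ∸ m))
      ≈⟨ Σ-cong (suc n) (λ m m≤n → trans (*-distribʳ-Σ (suc m) _ _)
           (Σ-cong (suc m) (λ i i≤m → trans (*-assoc _ _ _)
             (*-congˡ (*-congˡ (reflexive (≡.cong h (n∸m≡n∸i∸[m∸i] (ℕP.≤-pred i≤m) (ℕP.≤-pred m≤n))))))))) ⟩
    Σ (suc n) (λ m → Σ (suc m) (λ i → F i (m ∸ i)))   ≈⟨ Σ-triangle (suc n) F ⟨
    Σ (suc n) (λ i → Σ (suc n ∸ i) (F i))
      ≈⟨ Σ-cong (suc n) (λ i i≤n → trans (reflexive (≡.cong (λ k → Σ k (F i)) (ℕP.+-∸-assoc 1 (ℕP.≤-pred i≤n))))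
                                          (sym (*-distribˡ-Σ (suc (n ∸ i)) _ _))) ⟩
    Σ (suc n) (λ i → f i * (g *ₛ h) (n ∸ i))          ∎
    where
    F : ℕ → ℕ → K
    F i j = f i * (g j * h (n ∸ i ∸ j))
    n∸m≡n∸i∸[m∸i] : ∀ {i m} → i ≤ℕ m → m ≤ℕ n → n ∸ m ≡ n ∸ i ∸ (m ∸ i)
    n∸m≡n∸i∸[m∸i] {i} {m} i≤m _ =
      ≡.trans (≡.cong (n ∸_) (≡.sym (ℕP.m+[n∸m]≡n i≤m))) (≡.sym (ℕP.∸-+-assoc n i (m ∸ i)))

  *ₛ-identityˡ : ∀ f → 1ₛ *ₛ f ≐ f
  *ₛ-identityˡ f n = begin
    Σ (suc n) (λ i → 1ₛ i * f (n ∸ i))                    ≈⟨ Σ-head n _ ⟩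
    ⟦ + 1 ⟧ * f n + Σ n (λ i → 0# * f (n ∸ suc i))
      ≈⟨ +-cong (trans (*-congʳ 1-homo) (*-identityˡ _)) (Σ-zero n (λ i _ → zeroˡ _)) ⟩
    f n + 0#                                              ≈⟨ +-identityʳ _ ⟩
    f n                                                   ∎

  seriesRing : CommutativeRing c ℓ
  seriesRing = record
    { isCommutativeRing = record
      { isRing = record
        { +-isAbelianGroup = record
          { isGroup = record
            { isMonoid = record
              { isSemigroup = record
                { isMagma = record
                  { isEquivalence = record
                    { refl = pw (λ _ → refl) ; sym = λ e → pw (sym ∘ at e) ; trans = λ e e′ → pw (λ n → trans (at e n) (at e′ n)) }
                  ; ∙-cong = λ e e′ → pw (λ n → +-cong (at e n) (at e′ n)) }
                ; assoc = λ _ _ _ → pw (λ _ → +-assoc _ _ _) }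
              ; identity = (λ _ → pw (λ _ → +-identityˡ _)) , (λ _ → pw (λ _ → +-identityʳ _)) }
            ; inverse = (λ _ → pw (λ _ → -‿inverseˡ _)) , (λ _ → pw (λ _ → -‿inverseʳ _))
            ; ⁻¹-cong = λ e → pw (-‿cong ∘ at e) }
          ; comm = λ _ _ → pw (λ _ → +-comm _ _) }
        ; *-cong = λ e e′ → pw (*ₛ-cong (at e) (at e′))
        ; *-assoc = λ f g h → pw (*ₛ-assoc f g h)
        ; *-identity = (λ f → pw (*ₛ-identityˡ f)) , (λ f → pw (λ n → trans (*ₛ-comm f 1ₛ n) (*ₛ-identityˡ f n)))
        ; distrib = (λ f g h → pw (λ n → trans (Σ-cong′ (suc n) (λ i → distribˡ _ _ _)) (Σ-distrib-+ (suc n) _ _)))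
                  , (λ f g h → pw (λ n → trans (Σ-cong′ (suc n) (λ i → distribʳ _ _ _)) (Σ-distrib-+ (suc n) _ _))) }
      ; *-comm = λ f g → pw (*ₛ-comm f g) } }

  constₛ-morphism : CommutativeRing.rawRing ℤP.+-*-commutativeRing -Raw-AlmostCommutative⟶ fromCommutativeRing seriesRing
  constₛ-morphism = record
    { ⟦_⟧ = constₛ
    ; +-homo = λ a b → pw λ { zero → +-homo a b ; (suc n) → sym (+-identityˡ 0#) }
    ; *-homo = λ a b → pw λ { zero → trans (*-homo a b) (sym (+-identityˡ _))
                            ; (suc n) → sym (trans (Σ-head (suc n) _) (trans (+-cong (zeroʳ _) (Σ-zero (suc n) (λ i _ → zeroˡ _))) (+-identityˡ 0#))) }
    ; -‿homo = λ a → pw λ { zero → -‿homo a ; (suc n) → sym -0#≈0# }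
    ; 0-homo = pw λ { zero → 0-homo ; (suc n) → refl }
    ; 1-homo = pw λ _ → refl }
    where open _-Raw-AlmostCommutative⟶_ ι

  *ₛ-at-0 : ∀ f g → (f *ₛ g) 0 ≈ f 0 * g 0
  *ₛ-at-0 f g = +-identityˡ _

  X*ₛ-at-0 : ∀ f → (X *ₛ f) 0 ≈ 0#
  X*ₛ-at-0 f = trans (+-identityˡ _) (zeroˡ _)

  X*ₛ-at-suc : ∀ f n → (X *ₛ f) (suc n) ≈ f n
  X*ₛ-at-suc f n = begin
    Σ (suc (suc n)) (λ i → X i * f (suc n ∸ i))                      ≈⟨ Σ-head (suc n) _ ⟩
    0# * f (suc n) + Σ (suc n) (λ i → X (suc i) * f (n ∸ i))         ≈⟨ +-cong (zeroˡ _) (Σ-head n _) ⟩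
    0# + (1# * f n + Σ n (λ i → 0# * f (n ∸ suc i)))                 ≈⟨ +-identityˡ _ ⟩
    1# * f n + Σ n (λ i → 0# * f (n ∸ suc i))                        ≈⟨ +-cong (*-identityˡ _) (Σ-zero n (λ i _ → zeroˡ _)) ⟩
    f n + 0#                                                         ≈⟨ +-identityʳ _ ⟩
    f n                                                              ∎

  private
    module SR = CommutativeRing seriesRing
    module SRP = Algebra.Properties.Ring SR.ring

  [1+X]*ₛ : ∀ f → (1ₛ +ₛ X) *ₛ f ≐ f +ₛ X *ₛ f
  [1+X]*ₛ f n = trans (at (SR.distribʳ f 1ₛ X) n) (+-congʳ (*ₛ-identityˡ f n))

  [1-X]*ₛ : ∀ f → (1ₛ +ₛ -ₛ X) *ₛ f ≐ f +ₛ -ₛ (X *ₛ f)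
  [1-X]*ₛ f n = trans (at (SR.distribʳ f 1ₛ (-ₛ X)) n) (+-cong (*ₛ-identityˡ f n) (sym (at (SRP.-‿distribˡ-* X f) n)))

  *ₛ-top : ∀ f g n → (∀ i → i <ℕ n → f i ≈ 0#) → (f *ₛ g) n ≈ f n * g 0
  *ₛ-top f g n low = begin
    Σ n (λ i → f i * g (n ∸ i)) + f n * g (n ∸ n)
      ≈⟨ +-cong (Σ-zero n (λ i i<n → trans (*-congʳ (low i i<n)) (zeroˡ _))) (*-congˡ (reflexive (≡.cong g (ℕP.n∸n≡0 n)))) ⟩
    0# + f n * g 0   ≈⟨ +-identityˡ _ ⟩
    f n * g 0        ∎

  cancel-regular : ∀ h → (∀ x → x * h 0 ≈ 0# → x ≈ 0#) → ∀ f → f *ₛ h ≐ 0ₛ → f ≐ 0ₛ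
  cancel-regular h regular f fh≈0 = <-rec _ step
    where
    step : ∀ n → (∀ {i} → i <ℕ n → f i ≈ 0#) → f n ≈ 0#
    step n ih = regular (f n) (trans (sym (*ₛ-top f h n (λ i → ih))) (fh≈0 n))

  cancel-unit-constant : ∀ h → h 0 ≈ 1# → ∀ f → h *ₛ f ≐ 0ₛ → f ≐ 0ₛ
  cancel-unit-constant h h₀≈1 f hf≈0 =
    cancel-regular h (λ x e → trans (sym (trans (*-congˡ h₀≈1) (*-identityʳ x))) e) f (λ n → trans (*ₛ-comm f h n) (hf≈0 n))

  OddSeries EvenSeries : Series → Set ℓ
  OddSeries f = ∀ k → f (2 *ℕ k) ≈ 0#
  EvenSeries f = ∀ k → f (suc (2 *ℕ k)) ≈ 0#

  odd*odd-at-odd : ∀ {f g} → OddSeries f → OddSeries g → ∀ m → (f *ₛ g) (suc (2 *ℕ m)) ≈ 0#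
  odd*odd-at-odd {f} {g} f-odd g-odd m = Σ-zero (suc (suc (2 *ℕ m))) term≈0
    where
    term≈0 : ∀ i → i <ℕ suc (suc (2 *ℕ m)) → f i * g (suc (2 *ℕ m) ∸ i) ≈ 0#
    term≈0 i _ with parity i
    ... | Even k = trans (*-congʳ (f-odd k)) (zeroˡ _)
    ... | Odd k =
      trans (*-congˡ (trans (reflexive (≡.cong g (≡.sym (ℕP.*-distribˡ-∸ 2 m k)))) (g-odd (m ∸ k)))) (zeroʳ _)

  odd*odd-at-even : ∀ {f g} → OddSeries f → OddSeries g → ∀ m →
    (f *ₛ g) (2 *ℕ m) ≈ Σ m (λ j → f (suc (2 *ℕ j)) * g (suc (2 *ℕ (m ∸ suc j))))
  odd*odd-at-even {f} {g} f-odd g-odd m = begin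
    Σ (2 *ℕ m) h + h (2 *ℕ m)
      ≈⟨ +-cong (Σ-even-odd m h) (trans (*-congʳ (f-odd m)) (zeroˡ _)) ⟩
    Σ m (λ j → h (2 *ℕ j) + h (suc (2 *ℕ j))) + 0#
      ≈⟨ +-identityʳ _ ⟩
    Σ m (λ j → h (2 *ℕ j) + h (suc (2 *ℕ j)))
      ≈⟨ Σ-cong m (λ j j<m → trans (+-congʳ (trans (*-congʳ (f-odd j)) (zeroˡ _)))
                             (trans (+-identityˡ _) (*-congˡ (reflexive (≡.cong g (2m∸[1+2j]≡1+2[m∸[1+j]] j<m)))))) ⟩
    Σ m (λ j → f (suc (2 *ℕ j)) * g (suc (2 *ℕ (m ∸ suc j)))) ∎
    where
    h : ℕ → K
    h i = f i * g (2 *ℕ m ∸ i)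

  even*odd-at-odd : ∀ {f g} → EvenSeries f → OddSeries g → ∀ n →
    (f *ₛ g) (suc (2 *ℕ n)) ≈ Σ (suc n) (λ k → f (2 *ℕ k) * g (suc (2 *ℕ (n ∸ k))))
  even*odd-at-odd {f} {g} f-even g-odd n = begin
    Σ (suc (suc (2 *ℕ n))) h                          ≈⟨ reflexive (≡.cong (λ k → Σ k h) (≡.sym (2*suc n))) ⟩
    Σ (2 *ℕ suc n) h                                  ≈⟨ Σ-even-odd (suc n) h ⟩
    Σ (suc n) (λ k → h (2 *ℕ k) + h (suc (2 *ℕ k)))
      ≈⟨ Σ-cong (suc n) (λ k k≤n → trans (+-congˡ (trans (*-congʳ (f-even k)) (zeroˡ _)))
                                   (trans (+-identityʳ _) (*-congˡ (reflexive (≡.cong g (1+2n∸2k≡1+2[n∸k] (ℕP.≤-pred k≤n))))))) ⟩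
    Σ (suc n) (λ k → f (2 *ℕ k) * g (suc (2 *ℕ (n ∸ k)))) ∎
    where
    h : ℕ → K
    h i = f i * g (suc (2 *ℕ n) ∸ i)

  -- For χ n = qⁿ, f ᵠ is the dilation f(qx) and D f the q-derivative (f(x) - f(qx))/x.
  module QDifference (χ : ℕ → K) (χ-0 : χ 0 ≈ 1#) (χ-+ : ∀ i j → χ (i +ℕ j) ≈ χ i * χ j) where

    infix 9 _ᵠ
    _ᵠ : Series → Series
    (f ᵠ) n = χ n * f n

    D : Series → Series
    D f n = (1# - χ (suc n)) * f (suc n)

    ᵠ-+ : ∀ f g → (f +ₛ g) ᵠ ≈ₛ f ᵠ +ₛ g ᵠ
    ᵠ-+ f g = pw λ n → distribˡ _ _ _

    D-+ : ∀ f g → D (f +ₛ g) ≈ₛ D f +ₛ D g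
    D-+ f g = pw λ n → distribˡ _ _ _

    ᵠ-neg : ∀ f → (-ₛ f) ᵠ ≈ₛ -ₛ (f ᵠ)
    ᵠ-neg f = pw λ n → sym (-‿distribʳ-* _ _)

    D-neg : ∀ f → D (-ₛ f) ≈ₛ -ₛ (D f)
    D-neg f = pw λ n → sym (-‿distribʳ-* _ _)

    ᵠ-const : ∀ k → (constₛ k) ᵠ ≈ₛ constₛ k
    ᵠ-const k = pw λ { zero → trans (*-congʳ χ-0) (*-identityˡ ⟦ k ⟧) ; (suc n) → zeroʳ _ }

    D-const : ∀ k → D (constₛ k) ≈ₛ 0ₛ
    D-const k = pw λ n → zeroʳ _

    χ-split : ∀ {i n} → i ≤ℕ n → χ n ≈ χ i * χ (n ∸ i)
    χ-split {i} i≤n = trans (reflexive (≡.cong χ (≡.sym (ℕP.m+[n∸m]≡n i≤n)))) (χ-+ i _)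

    ᵠ-* : ∀ f g → (f *ₛ g) ᵠ ≈ₛ f ᵠ *ₛ g ᵠ
    ᵠ-* f g = pw λ n → trans (*-distribˡ-Σ (suc n) _ _) (Σ-cong (suc n) (λ i i≤n →
      trans (*-congʳ (χ-split (ℕP.≤-pred i≤n)))
            (solve 4 (λ a b x y → (a :* b) :* (x :* y) := (a :* x) :* (b :* y)) refl _ _ _ _)))

    1-χ-0 : 1# - χ 0 ≈ 0#
    1-χ-0 = trans (+-congˡ (-‿cong χ-0)) (-‿inverseʳ 1#)

    private
      1-ab-split : ∀ a b x y → (1# - a * b) * (x * y) ≈ ((1# - a) * x) * y + (a * x) * ((1# - b) * y)
      1-ab-split a b x y = begin
        (1# - a * b) * (x * y)                                  ≈⟨ *-congʳ (+-congʳ 1-homo) ⟨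
        (⟦ + 1 ⟧ - a * b) * (x * y)
          ≈⟨ solve 4 (λ a b x y → (con (+ 1) :- a :* b) :* (x :* y)
                              := ((con (+ 1) :- a) :* x) :* y :+ (a :* x) :* ((con (+ 1) :- b) :* y)) refl a b x y ⟩
        ((⟦ + 1 ⟧ - a) * x) * y + (a * x) * ((⟦ + 1 ⟧ - b) * y)
          ≈⟨ +-cong (*-congʳ (*-congʳ (+-congʳ 1-homo))) (*-congˡ (*-congʳ (+-congʳ 1-homo))) ⟩
        ((1# - a) * x) * y + (a * x) * ((1# - b) * y)           ∎

    -- The q-Leibniz rule: split 1 - χ(n+1) = (1 - χ i) + χ i (1 - χ(n+1-i)) in every term of the product.
    D-* : ∀ f g → D (f *ₛ g) ≈ₛ D f *ₛ g +ₛ f ᵠ *ₛ D g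
    D-* f g = pw coefficient
      where
      coefficient : ∀ n → D (f *ₛ g) n ≈ (D f *ₛ g +ₛ f ᵠ *ₛ D g) n
      coefficient n = begin
        (1# - χ (suc n)) * Σ (suc (suc n)) (λ i → f i * g (suc n ∸ i))
          ≈⟨ *-distribˡ-Σ (suc (suc n)) _ _ ⟩
        Σ (suc (suc n)) (λ i → (1# - χ (suc n)) * (f i * g (suc n ∸ i)))
          ≈⟨ Σ-cong (suc (suc n)) (λ i i≤1+n → trans (*-congʳ (+-congˡ (-‿cong (χ-split (ℕP.≤-pred i≤1+n))))) (1-ab-split _ _ _ _)) ⟩
        Σ (suc (suc n)) (λ i → left i + right i)      ≈⟨ Σ-distrib-+ (suc (suc n)) left right ⟩
        Σ (suc (suc n)) left + Σ (suc (suc n)) right  ≈⟨ +-cong left-sum right-sum ⟩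
        (D f *ₛ g) n + (f ᵠ *ₛ D g) n ∎
        where
        left right : ℕ → K
        left i = ((1# - χ i) * f i) * g (suc n ∸ i)
        right i = (χ i * f i) * ((1# - χ (suc n ∸ i)) * g (suc n ∸ i))
        left-sum : Σ (suc (suc n)) left ≈ (D f *ₛ g) n
        left-sum = begin
          Σ (suc (suc n)) left                 ≈⟨ Σ-head (suc n) left ⟩
          left 0 + Σ (suc n) (left ∘ suc)      ≈⟨ +-congʳ (trans (*-congʳ (trans (*-congʳ 1-χ-0) (zeroˡ _))) (zeroˡ _)) ⟩
          0# + Σ (suc n) (left ∘ suc)          ≈⟨ +-identityˡ _ ⟩
          (D f *ₛ g) n                         ∎
        right-sum : Σ (suc (suc n)) right ≈ (f ᵠ *ₛ D g) n
        right-sum = begin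
          Σ (suc n) right + right (suc n)
            ≈⟨ +-congˡ (trans (*-congˡ (trans (*-congʳ (trans (+-congˡ (-‿cong (reflexive (≡.cong χ (ℕP.n∸n≡0 (suc n)))))) 1-χ-0)) (zeroˡ _))) (zeroʳ _)) ⟩
          Σ (suc n) right + 0#   ≈⟨ +-identityʳ _ ⟩
          Σ (suc n) right
            ≈⟨ Σ-cong (suc n) (λ i i≤n → reflexive (≡.cong (λ k → (χ i * f i) * ((1# - χ k) * g k)) (ℕP.+-∸-assoc 1 (ℕP.≤-pred i≤n)))) ⟩
          (f ᵠ *ₛ D g) n         ∎

    -- Coefficient n of D u determines u (n+1) once the factor 1 - χ (n+1) is regular.
    linear-solution-unique : (∀ n x → (1# - χ (suc n)) * x ≈ 0# → x ≈ 0#) →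
      ∀ (u a b : Series) → u 0 ≈ 0# → D u ≈ₛ a *ₛ u +ₛ b *ₛ (u ᵠ) → u ≈ₛ 0ₛ
    linear-solution-unique regular u a b u₀≈0 Du≈ = pw (<-rec _ step)
      where
      step : ∀ n → (∀ {i} → i <ℕ n → u i ≈ 0#) → u n ≈ 0#
      step zero _ = u₀≈0
      step (suc n) ih = regular n (u (suc n)) (begin
        D u n                                 ≈⟨ at Du≈ n ⟩
        (a *ₛ u) n + (b *ₛ (u ᵠ)) n
          ≈⟨ +-cong (Σ-zero (suc n) (λ i _ → trans (*-congˡ (below i)) (zeroʳ _)))
                    (Σ-zero (suc n) (λ i _ → trans (*-congˡ (trans (*-congˡ (below i)) (zeroʳ _))) (zeroʳ _))) ⟩
        0# + 0#                               ≈⟨ +-identityˡ _ ⟩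
        0#                                    ∎)
        where
        below : ∀ i → u (n ∸ i) ≈ 0#
        below i = ih (s≤s (ℕP.m∸n≤m n i))

module QSeries where

  open import Defs
  open import Algebra
  open import Algebra.Solver.Ring.AlmostCommutativeRing using (fromCommutativeRing; -raw-almostCommutative⟶)
  open import Data.Bool using (T; true; false)
  open import Data.Empty using (⊥-elim)
  open import Data.Integer as ℤ using (ℤ; +_; -_)
  import Data.Integer.Properties as ℤP
  open import Data.Nat using (ℕ; zero; suc; _+_; _∸_; _≤_; _<_; z≤n; s≤s; _≤ᵇ_)
  import Data.Nat.Properties as ℕP
  open import Data.Sum using (inj₁; inj₂)
  open import Function using (_∘_)
  open import Relation.Binary.PropositionalEquality as ≡ using (_≡_; refl)

  open Arithmetic using (≤⇒>ᵇ≡false)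
  -- ℤ[[q]] as power series over ℤ, whose indeterminate X is q.
  open PowerSeries ℤP.+-*-commutativeRing (-raw-almostCommutative⟶ (fromCommutativeRing ℤP.+-*-commutativeRing)) public
  open FiniteSums ℤP.+-*-commutativeRing using () renaming (Σ to Σℤ; Σ-cong to Σℤ-cong; Σ-head to Σℤ-head)
  open FiniteSums seriesRing public
  open RingSolver seriesRing constₛ-morphism
  module S = CommutativeRing seriesRing
  open import Algebra.Properties.Ring S.ring public using (-0#≈0#; -‿distribˡ-*)
  open import Relation.Binary.Reasoning.Setoid S.setoid

  sumℤ≡Σℤ : ∀ n h → sumℤ n h ≡ Σℤ n h
  sumℤ≡Σℤ zero h = refl
  sumℤ≡Σℤ (suc n) h = ≡.cong (ℤ._+ h n) (sumℤ≡Σℤ n h)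

  ⊗≈*ₛ : ∀ f g → f ⊗ g ≈ₛ f *ₛ g
  ⊗≈*ₛ f g = pw λ d → sumℤ≡Σℤ (suc d) _

  ⊗³≈*ₛ : ∀ f g h → f ⊗ g ⊗ h ≈ₛ f *ₛ g *ₛ h
  ⊗³≈*ₛ f g h = S.trans (⊗≈*ₛ (f ⊗ g) h) (S.*-congʳ {h} (⊗≈*ₛ f g))

  ⊗⁴≈*ₛ : ∀ e f g h → e ⊗ f ⊗ g ⊗ h ≈ₛ e *ₛ f *ₛ g *ₛ h
  ⊗⁴≈*ₛ e f g h = S.trans (⊗≈*ₛ (e ⊗ f ⊗ g) h) (S.*-congʳ {h} (⊗³≈*ₛ e f g))

  1PS≈1ₛ : 1PS ≈ₛ 1ₛ
  1PS≈1ₛ = pw λ { zero → refl ; (suc d) → refl }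

  const≈constₛ : ∀ c → const c ≈ₛ constₛ c
  const≈constₛ c = pw λ { zero → refl ; (suc d) → refl }

  const⊗≈constₛ*ₛ : ∀ c f → const c ⊗ f ≈ₛ constₛ c *ₛ f
  const⊗≈constₛ*ₛ c f = S.trans (⊗≈*ₛ (const c) f) (S.*-congʳ {f} (const≈constₛ c))

  sumPS≈Σ : ∀ n F → sumPS n F ≈ₛ Σ n F
  sumPS≈Σ zero F = pw λ _ → refl
  sumPS≈Σ (suc n) F = pw λ d → ≡.cong (ℤ._+ F n d) (at (sumPS≈Σ n F) d)

  qpow-0 : qpow 0 ≈ₛ 1ₛ
  qpow-0 = pw λ { zero → refl ; (suc d) → refl }

  qpow-suc : ∀ k → qpow (suc k) ≈ₛ X *ₛ qpow k
  qpow-suc k = pw λ { zero → ≡.sym (X*ₛ-at-0 (qpow k)) ; (suc d) → ≡.sym (X*ₛ-at-suc (qpow k) d) }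

  qpow-+ : ∀ a b → qpow (a + b) ≈ₛ qpow a *ₛ qpow b
  qpow-+ zero b = S.sym (S.trans (S.*-congʳ {qpow b} qpow-0) (S.*-identityˡ (qpow b)))
  qpow-+ (suc a) b = begin
    qpow (suc (a + b))        ≈⟨ qpow-suc (a + b) ⟩
    X *ₛ qpow (a + b)         ≈⟨ S.*-congˡ {X} (qpow-+ a b) ⟩
    X *ₛ (qpow a *ₛ qpow b)   ≈⟨ S.*-assoc X (qpow a) (qpow b) ⟨
    (X *ₛ qpow a) *ₛ qpow b   ≈⟨ S.*-congʳ {qpow b} (qpow-suc a) ⟨
    qpow (suc a) *ₛ qpow b    ∎

  module _ (f : PS) where

    invUpTo-stable : ∀ n k → k ≤ n → invUpTo f n k ≡ inv f k
    invUpTo-stable zero .zero z≤n = refl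
    invUpTo-stable (suc n) k k≤1+n with ℕP.m≤n⇒m<n∨m≡n k≤1+n
    ... | inj₂ refl = refl
    ... | inj₁ (s≤s k≤n) with k ≤ᵇ n in k≤ᵇn
    ...   | true = invUpTo-stable n k k≤n
    ...   | false = ⊥-elim (≡.subst T k≤ᵇn (ℕP.≤⇒≤ᵇ k≤n))

    inv-suc : ∀ n → inv f (suc n) ≡ - Σℤ (suc n) (λ j → f (suc j) ℤ.* inv f (n ∸ j))
    inv-suc n rewrite ≤⇒>ᵇ≡false (ℕP.≤-refl {n}) = ≡.cong -_ (≡.trans (sumℤ≡Σℤ (suc n) _)
      (Σℤ-cong (suc n) (λ j _ → ≡.cong (f (suc j) ℤ.*_) (invUpTo-stable n (n ∸ j) (ℕP.m∸n≤m n j)))))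

    *ₛ-inv : f 0 ≡ + 1 → f *ₛ inv f ≈ₛ 1ₛ
    *ₛ-inv f₀≡1 = pw λ
      { zero → ≡.trans (ℤP.+-identityˡ _) (≡.cong (ℤ._* + 1) f₀≡1)
      ; (suc n) → ≡.trans (Σℤ-head (suc n) _)
          (≡.trans (≡.cong₂ ℤ._+_ (≡.trans (≡.cong₂ ℤ._*_ f₀≡1 (inv-suc n)) (ℤP.*-identityˡ _)) refl)
                   (ℤP.+-inverseˡ (Σℤ (suc n) (λ j → f (suc j) ℤ.* inv f (n ∸ j))))) }

  1-q^ 1+q^ : ℕ → PS
  1-q^ k = 1ₛ +ₛ -ₛ qpow k
  1+q^ k = 1ₛ +ₛ qpow k

  1-q^suc-regular : ∀ n x → 1-q^ (suc n) *ₛ x ≈ₛ 0ₛ → x ≈ₛ 0ₛ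
  1-q^suc-regular n x e = pw (cancel-unit-constant (1-q^ (suc n)) refl x (at e))

  4-regular : ∀ x → x *ₛ constₛ (+ 4) ≈ₛ 0ₛ → x ≈ₛ 0ₛ
  4-regular x e = pw (cancel-regular (constₛ (+ 4)) (λ y y4≡0 → ℤP.*-cancelʳ-≡ y (+ 0) (+ 4) y4≡0) x (at e))

  qPoch-suc : ∀ n → qPoch (suc n) ≈ₛ qPoch n *ₛ 1-q^ (suc n)
  qPoch-suc n = S.trans (⊗≈*ₛ (qPoch n) (1PS ⊕ ⊖ qpow (suc n))) (S.*-congˡ {qPoch n} (S.+-congʳ { -ₛ qpow (suc n)} 1PS≈1ₛ))

  negqPoch-suc : ∀ n → negqPoch (suc n) ≈ₛ negqPoch n *ₛ 1+q^ (suc n)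
  negqPoch-suc n = S.trans (⊗≈*ₛ (negqPoch n) (1PS ⊕ qpow (suc n))) (S.*-congˡ {negqPoch n} (S.+-congʳ {qpow (suc n)} 1PS≈1ₛ))

  qPoch-at-0 : ∀ n → qPoch n 0 ≡ + 1
  qPoch-at-0 zero = refl
  qPoch-at-0 (suc n) = ≡.trans (ℤP.+-identityˡ _) (≡.cong (ℤ._* (+ 1 ℤ.+ - + 0)) (qPoch-at-0 n))

  qPoch⁻¹ : ℕ → PS
  qPoch⁻¹ k = inv (qPoch k)

  qPoch-*-qPoch⁻¹ : ∀ k → qPoch k *ₛ qPoch⁻¹ k ≈ₛ 1ₛ
  qPoch-*-qPoch⁻¹ k = *ₛ-inv (qPoch k) (qPoch-at-0 k)

  qPoch⁻¹-0 : qPoch⁻¹ 0 ≈ₛ 1ₛ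
  qPoch⁻¹-0 = S.trans (S.sym (S.*-identityˡ (qPoch⁻¹ 0))) (S.trans (S.*-congʳ {qPoch⁻¹ 0} (S.sym 1PS≈1ₛ)) (qPoch-*-qPoch⁻¹ 0))

  qPoch⁻¹-suc : ∀ k → 1-q^ (suc k) *ₛ qPoch⁻¹ (suc k) ≈ₛ qPoch⁻¹ k
  qPoch⁻¹-suc k = begin
    o *ₛ J                       ≈⟨ S.*-identityʳ (o *ₛ J) ⟨
    (o *ₛ J) *ₛ 1ₛ               ≈⟨ S.*-congˡ {o *ₛ J} (qPoch-*-qPoch⁻¹ k) ⟨
    (o *ₛ J) *ₛ (P *ₛ I)         ≈⟨ solve 4 (λ o J P I → (o :* J) :* (P :* I) := ((P :* o) :* J) :* I) S.refl o J P I ⟩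
    ((P *ₛ o) *ₛ J) *ₛ I         ≈⟨ S.*-congʳ {I} (S.*-congʳ {J} (qPoch-suc k)) ⟨
    (qPoch (suc k) *ₛ J) *ₛ I    ≈⟨ S.*-congʳ {I} (qPoch-*-qPoch⁻¹ (suc k)) ⟩
    1ₛ *ₛ I                      ≈⟨ S.*-identityˡ I ⟩
    I                            ∎
    where
    o J P I : PS
    o = 1-q^ (suc k)
    J = qPoch⁻¹ (suc k)
    P = qPoch k
    I = qPoch⁻¹ k

  qPascal : ℕ → ℕ → PS
  qPascal n zero = 1ₛ
  qPascal zero (suc k) = 0ₛ
  qPascal (suc n) (suc k) = qPascal n k +ₛ qpow (suc k) *ₛ qPascal n (suc k)

  qPascal-beyond : ∀ {n k} → n < k → qPascal n k ≈ₛ 0ₛ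
  qPascal-beyond {zero} {suc k} _ = S.refl
  qPascal-beyond {suc n} {suc k} (s≤s n<k) = begin
    qPascal n k +ₛ qpow (suc k) *ₛ qPascal n (suc k)
      ≈⟨ S.+-cong (qPascal-beyond n<k) (S.*-congˡ {qpow (suc k)} (qPascal-beyond (ℕP.m<n⇒m<1+n n<k))) ⟩
    0ₛ +ₛ qpow (suc k) *ₛ 0ₛ   ≈⟨ S.trans (S.+-identityˡ _) (S.zeroʳ (qpow (suc k))) ⟩
    0ₛ                         ∎

  qPascal-diagonal : ∀ n → qPascal n n ≈ₛ 1ₛ
  qPascal-diagonal zero = S.refl
  qPascal-diagonal (suc n) = begin
    qPascal n n +ₛ qpow (suc n) *ₛ qPascal n (suc n)
      ≈⟨ S.+-cong (qPascal-diagonal n) (S.*-congˡ {qpow (suc n)} (qPascal-beyond (ℕP.n<1+n n))) ⟩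
    1ₛ +ₛ qpow (suc n) *ₛ 0ₛ   ≈⟨ S.trans (S.+-congˡ {1ₛ} (S.zeroʳ (qpow (suc n)))) (S.+-identityʳ 1ₛ) ⟩
    1ₛ                         ∎

  qPascal-*-qPoch-diagonal : ∀ n → qPascal n n *ₛ qPoch (n ∸ n) *ₛ qPoch n ≈ₛ qPoch n
  qPascal-*-qPoch-diagonal n = begin
    qPascal n n *ₛ qPoch (n ∸ n) *ₛ qPoch n
      ≈⟨ S.*-congʳ {qPoch n} (S.*-cong (qPascal-diagonal n) (S.trans (S.reflexive (≡.cong qPoch (ℕP.n∸n≡0 n))) 1PS≈1ₛ)) ⟩
    1ₛ *ₛ 1ₛ *ₛ qPoch n   ≈⟨ S.trans (S.*-congʳ {qPoch n} (S.*-identityˡ 1ₛ)) (S.*-identityˡ _) ⟩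
    qPoch n              ∎

  qPascal-*-qPoch : ∀ {n k} → k ≤ n → qPascal n k *ₛ qPoch (n ∸ k) *ₛ qPoch k ≈ₛ qPoch n
  qPascal-*-qPoch {n} {zero} _ = S.trans (S.*-cong (S.*-identityˡ (qPoch n)) 1PS≈1ₛ) (S.*-identityʳ (qPoch n))
  qPascal-*-qPoch {suc n} {suc k} (s≤s k≤n) with ℕP.m≤n⇒m<n∨m≡n k≤n
  ... | inj₂ refl = qPascal-*-qPoch-diagonal (suc k)
  ... | inj₁ k<n = begin
    (a +ₛ u *ₛ b) *ₛ qPoch (n ∸ k) *ₛ qPoch (suc k)
      ≈⟨ S.*-cong (S.*-congˡ {a +ₛ u *ₛ b} qPoch[n∸k]) (qPoch-suc k) ⟩
    (a +ₛ u *ₛ b) *ₛ (A *ₛ 1-q^ (suc (n ∸ suc k))) *ₛ (B *ₛ 1-q^ (suc k))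
      ≈⟨ solve 6 (λ a b u A B v → (a :+ u :* b) :* (A :* (con (+ 1) :- v)) :* (B :* (con (+ 1) :- u))
                   := (a :* (A :* (con (+ 1) :- v)) :* B) :* (con (+ 1) :- u)
                      :+ u :* ((b :* A :* (B :* (con (+ 1) :- u))) :* (con (+ 1) :- v))) S.refl a b u A B v ⟩
    (a *ₛ (A *ₛ 1-q^ (suc (n ∸ suc k))) *ₛ B) *ₛ 1-q^ (suc k) +ₛ u *ₛ ((b *ₛ A *ₛ (B *ₛ 1-q^ (suc k))) *ₛ 1-q^ (suc (n ∸ suc k)))
      ≈⟨ S.+-cong (S.*-congʳ {1-q^ (suc k)} lower) (S.*-congˡ {u} (S.*-congʳ {1-q^ (suc (n ∸ suc k))} upper)) ⟩
    W *ₛ 1-q^ (suc k) +ₛ u *ₛ (W *ₛ 1-q^ (suc (n ∸ suc k)))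
      ≈⟨ solve 3 (λ W u v → W :* (con (+ 1) :- u) :+ u :* (W :* (con (+ 1) :- v)) := W :* (con (+ 1) :- u :* v)) S.refl W u v ⟩
    W *ₛ (1ₛ +ₛ -ₛ (u *ₛ v))    ≈⟨ S.*-congˡ {W} (S.+-congˡ {1ₛ} (S.-‿cong (S.sym q^[1+n]≈uv))) ⟩
    W *ₛ 1-q^ (suc n)           ≈⟨ qPoch-suc n ⟨
    qPoch (suc n)               ∎
    where
    a b u v A B W : PS
    a = qPascal n k
    b = qPascal n (suc k)
    u = qpow (suc k)
    v = qpow (suc (n ∸ suc k))
    A = qPoch (n ∸ suc k)
    B = qPoch k
    W = qPoch n
    n∸k≡1+[n∸1+k] : n ∸ k ≡ suc (n ∸ suc k)
    n∸k≡1+[n∸1+k] = ℕP.+-∸-assoc 1 k<n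
    qPoch[n∸k] : qPoch (n ∸ k) ≈ₛ A *ₛ 1-q^ (suc (n ∸ suc k))
    qPoch[n∸k] = S.trans (S.reflexive (≡.cong qPoch n∸k≡1+[n∸1+k])) (qPoch-suc (n ∸ suc k))
    lower : a *ₛ (A *ₛ 1-q^ (suc (n ∸ suc k))) *ₛ B ≈ₛ W
    lower = S.trans (S.*-congʳ {B} (S.*-congˡ {a} (S.sym qPoch[n∸k]))) (qPascal-*-qPoch k≤n)
    upper : b *ₛ A *ₛ (B *ₛ 1-q^ (suc k)) ≈ₛ W
    upper = S.trans (S.*-congˡ {b *ₛ A} (S.sym (qPoch-suc k))) (qPascal-*-qPoch k<n)
    q^[1+n]≈uv : qpow (suc n) ≈ₛ u *ₛ v
    q^[1+n]≈uv = S.trans (S.reflexive (≡.cong (qpow ∘ suc) (≡.sym (≡.trans (≡.cong (_+_ k) (≡.sym n∸k≡1+[n∸1+k])) (ℕP.m+[n∸m]≡n k≤n)))))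
                         (qpow-+ (suc k) (suc (n ∸ suc k)))

  qPascal≈qPoch-quotient : ∀ {n k} → k ≤ n → qPascal n k ≈ₛ qPoch n *ₛ qPoch⁻¹ (n ∸ k) *ₛ qPoch⁻¹ k
  qPascal≈qPoch-quotient {n} {k} k≤n = begin
    a                                      ≈⟨ S.*-identityʳ a ⟨
    a *ₛ 1ₛ                                ≈⟨ S.*-congˡ {a} (S.*-identityʳ 1ₛ) ⟨
    a *ₛ (1ₛ *ₛ 1ₛ)                        ≈⟨ S.*-congˡ {a} (S.*-cong (qPoch-*-qPoch⁻¹ (n ∸ k)) (qPoch-*-qPoch⁻¹ k)) ⟨
    a *ₛ ((A *ₛ A⁻¹) *ₛ (B *ₛ B⁻¹))
      ≈⟨ solve 5 (λ a A A⁻¹ B B⁻¹ → a :* ((A :* A⁻¹) :* (B :* B⁻¹)) := (a :* A :* B) :* A⁻¹ :* B⁻¹) S.refl a A A⁻¹ B B⁻¹ ⟩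
    (a *ₛ A *ₛ B) *ₛ A⁻¹ *ₛ B⁻¹            ≈⟨ S.*-congʳ {B⁻¹} (S.*-congʳ {A⁻¹} (qPascal-*-qPoch k≤n)) ⟩
    qPoch n *ₛ A⁻¹ *ₛ B⁻¹                  ∎
    where
    a A A⁻¹ B B⁻¹ : PS
    a = qPascal n k
    A = qPoch (n ∸ k)
    A⁻¹ = qPoch⁻¹ (n ∸ k)
    B = qPoch k
    B⁻¹ = qPoch⁻¹ k

  qbin≈qPascal : ∀ {n k} → k ≤ n → qbin n k ≈ₛ qPascal n k
  qbin≈qPascal {n} {k} k≤n = begin
    qPoch n ⊗ inv AB                ≈⟨ ⊗≈*ₛ (qPoch n) (inv AB) ⟩
    qPoch n *ₛ inv AB               ≈⟨ S.*-congʳ {inv AB} (qPascal-*-qPoch k≤n) ⟨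
    (a *ₛ A *ₛ B) *ₛ inv AB         ≈⟨ solve 4 (λ a A B I → (a :* A :* B) :* I := a :* ((A :* B) :* I)) S.refl a A B (inv AB) ⟩
    a *ₛ ((A *ₛ B) *ₛ inv AB)       ≈⟨ S.*-congˡ {a} (S.trans (S.*-congʳ {inv AB} (S.sym (⊗≈*ₛ A B))) (*ₛ-inv AB AB₀≡1)) ⟩
    a *ₛ 1ₛ                         ≈⟨ S.*-identityʳ a ⟩
    a                               ∎
    where
    a A B AB : PS
    a = qPascal n k
    A = qPoch (n ∸ k)
    B = qPoch k
    AB = A ⊗ B
    AB₀≡1 : AB 0 ≡ + 1
    AB₀≡1 = ≡.trans (ℤP.+-identityˡ _) (≡.cong₂ ℤ._*_ (qPoch-at-0 (n ∸ k)) (qPoch-at-0 k))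

module ConstraintWords where

  open import Defs using (altFrom; invs)
  open import Data.Bool using (Bool; true; false; _∧_)
  open import Data.Bool.Properties using (∧-assoc; ∧-comm)
  open import Data.List using (List; []; _∷_; length; filter)
  open import Data.List.Properties using (filter-none)
  open import Data.List.Relation.Unary.All as All using (All; []; _∷_)
  open import Data.Nat using (ℕ; zero; suc; pred; _+_; _*_; _≤_; _<_; z≤n; s≤s; _<ᵇ_; _<?_)
  import Data.Nat.Properties as ℕP
  open import Function using (_∘_)
  open import Relation.Binary.PropositionalEquality as ≡ using (_≡_; refl; _≗_)
  open ≡.≡-Reasoning

  open Arithmetic

  data Constraint : Set where
    descent ascent free : Constraint

  allowsDescent allowsAscent : Constraint → Bool
  allowsDescent ascent = false
  allowsDescent _ = true
  allowsAscent descent = false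
  allowsAscent _ = true

  holds : Constraint → ℕ → ℕ → Bool
  holds descent x y = y <ᵇ x
  holds ascent x y = x <ᵇ y
  holds free _ _ = true

  holds-< : ∀ c {x y} → x < y → holds c x y ≡ allowsAscent c
  holds-< descent x<y = ≤⇒>ᵇ≡false (ℕP.<⇒≤ x<y)
  holds-< ascent x<y = <⇒<ᵇ≡true x<y
  holds-< free _ = refl

  holds-> : ∀ c {x y} → x < y → holds c y x ≡ allowsDescent c
  holds-> descent x<y = <⇒<ᵇ≡true x<y
  holds-> ascent x<y = ≤⇒>ᵇ≡false (ℕP.<⇒≤ x<y)
  holds-> free _ = refl

  -- Entry i of a word constrains entries i and i + 1 of a permutation (counting from 0).
  Word : Set
  Word = ℕ → Constraint

  infixr 5 _◂_
  _◂_ : Constraint → Word → Word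
  (c ◂ w) zero = c
  (c ◂ w) (suc i) = w i

  ◂-cong : ∀ c {w w′} → w ≗ w′ → c ◂ w ≗ c ◂ w′
  ◂-cong c e zero = refl
  ◂-cong c e (suc i) = e i

  satisfies : Word → List ℕ → Bool
  satisfies w [] = true
  satisfies w (x ∷ []) = true
  satisfies w (x ∷ y ∷ r) = holds (w 0) x y ∧ satisfies (w ∘ suc) (y ∷ r)

  satisfies-free◂ : ∀ w y ys → satisfies (free ◂ w) (y ∷ ys) ≡ satisfies w ys
  satisfies-free◂ w y [] = refl
  satisfies-free◂ w y (z ∷ zs) = refl

  alternating : Word
  alternating zero = descent
  alternating (suc zero) = ascent
  alternating (suc (suc i)) = alternating i

  altFrom≡satisfies : ∀ π → altFrom true π ≡ satisfies alternating π
  altFrom≡satisfies π = go true π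
    where
    from : Bool → Word
    from true = alternating
    from false = alternating ∘ suc
    go : ∀ b π → altFrom b π ≡ satisfies (from b) π
    go b [] = refl
    go b (x ∷ []) = refl
    go true (x ∷ y ∷ r) = ≡.cong ((y <ᵇ x) ∧_) (go false (y ∷ r))
    go false (x ∷ y ∷ r) = ≡.cong ((x <ᵇ y) ∧_) (go true (y ∷ r))

  insertAt : ℕ → ℕ → List ℕ → List ℕ
  insertAt zero x σ = x ∷ σ
  insertAt (suc p) x [] = x ∷ []
  insertAt (suc p) x (y ∷ ys) = y ∷ insertAt p x ys

  -- Whether a new minimum may sit at position p of a permutation of length n + 1:
  -- its left neighbour must descend to it and its right neighbour ascend from it.
  insertable : Word → ℕ → ℕ → Bool
  insertable w zero zero = true
  insertable w zero (suc _) = allowsAscent (w 0)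
  insertable w (suc zero) n = allowsDescent (w 0) ∧ insertable (w ∘ suc) zero (pred n)
  insertable w (suc (suc p)) n = insertable (w ∘ suc) (suc p) (pred n)

  -- The constraints left on the other entries once the minimum at position p is removed.
  residual : Word → ℕ → Word
  residual w zero = w ∘ suc
  residual w (suc zero) = free ◂ w ∘ suc ∘ suc
  residual w (suc (suc p)) = w 0 ◂ residual (w ∘ suc) (suc p)

  insertable-cong : ∀ {w w′} → w ≗ w′ → ∀ p n → insertable w p n ≡ insertable w′ p n
  insertable-cong e zero zero = refl
  insertable-cong e zero (suc n) = ≡.cong allowsAscent (e 0)
  insertable-cong e (suc zero) n = ≡.cong₂ _∧_ (≡.cong allowsDescent (e 0)) (insertable-cong (e ∘ suc) zero (pred n))
  insertable-cong e (suc (suc p)) n = insertable-cong (e ∘ suc) (suc p) (pred n)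

  residual-cong : ∀ {w w′} → w ≗ w′ → ∀ p → residual w p ≗ residual w′ p
  residual-cong e zero = e ∘ suc
  residual-cong e (suc zero) = ◂-cong free (e ∘ suc ∘ suc)
  residual-cong e (suc (suc p)) zero = e 0
  residual-cong e (suc (suc p)) (suc i) = residual-cong (e ∘ suc) (suc p) i

  satisfies-insertAt : ∀ w p x σ → All (x <_) σ → p ≤ length σ →
    satisfies w (insertAt p x σ) ≡ insertable w p (length σ) ∧ satisfies (residual w p) σ
  satisfies-insertAt w zero x [] _ _ = refl
  satisfies-insertAt w zero x (y ∷ ys) (x<y ∷ _) _ = ≡.cong (_∧ satisfies (w ∘ suc) (y ∷ ys)) (holds-< (w 0) x<y)
  satisfies-insertAt w (suc zero) x (y ∷ ys) (x<y ∷ x<ys) _ = begin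
    holds (w 0) y x ∧ satisfies (w ∘ suc) (x ∷ ys)
      ≡⟨ ≡.cong₂ _∧_ (holds-> (w 0) x<y) (satisfies-insertAt (w ∘ suc) zero x ys x<ys z≤n) ⟩
    allowsDescent (w 0) ∧ (insertable (w ∘ suc) 0 (length ys) ∧ satisfies (w ∘ suc ∘ suc) ys)
      ≡⟨ ∧-assoc (allowsDescent (w 0)) _ _ ⟨
    (allowsDescent (w 0) ∧ insertable (w ∘ suc) 0 (length ys)) ∧ satisfies (w ∘ suc ∘ suc) ys
      ≡⟨ ≡.cong (_ ∧_) (satisfies-free◂ (w ∘ suc ∘ suc) y ys) ⟨
    insertable w 1 (suc (length ys)) ∧ satisfies (residual w 1) (y ∷ ys) ∎
  satisfies-insertAt w (suc (suc p)) x (y ∷ y′ ∷ ys) (_ ∷ x<σ) (s≤s p≤) = begin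
    h ∧ satisfies (w ∘ suc) (insertAt (suc p) x (y′ ∷ ys))
      ≡⟨ ≡.cong (h ∧_) (satisfies-insertAt (w ∘ suc) (suc p) x (y′ ∷ ys) x<σ p≤) ⟩
    h ∧ (i ∧ s)             ≡⟨ ∧-assoc h i s ⟨
    (h ∧ i) ∧ s             ≡⟨ ≡.cong (_∧ s) (∧-comm h i) ⟩
    (i ∧ h) ∧ s             ≡⟨ ∧-assoc i h s ⟩
    i ∧ (h ∧ s)             ∎
    where
    h i s : Bool
    h = holds (w 0) y y′
    i = insertable (w ∘ suc) (suc p) (length (y′ ∷ ys))
    s = satisfies (residual (w ∘ suc) (suc p)) (y′ ∷ ys)

  count< : ℕ → List ℕ → ℕ
  count< x σ = length (filter (_<? x) σ)

  count<-above : ∀ x σ → All (x <_) σ → count< x σ ≡ 0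
  count<-above x σ x<σ = ≡.cong length (filter-none (_<? x) (All.map (λ x<y y<x → ℕP.<-asym x<y y<x) x<σ))

  count<-insertAt : ∀ p {x y} ys → x < y → count< y (insertAt p x ys) ≡ suc (count< y ys)
  count<-insertAt zero ys x<y rewrite <⇒<ᵇ≡true x<y = refl
  count<-insertAt (suc p) [] x<y rewrite <⇒<ᵇ≡true x<y = refl
  count<-insertAt (suc p) {y = y} (z ∷ zs) x<y with z <ᵇ y
  ... | true = ≡.cong suc (count<-insertAt p zs x<y)
  ... | false = count<-insertAt p zs x<y

  invs-insertAt : ∀ p x σ → All (x <_) σ → p ≤ length σ → invs (insertAt p x σ) ≡ p + invs σ
  invs-insertAt zero x σ x<σ _ = ≡.cong (_+ invs σ) (count<-above x σ x<σ)
  invs-insertAt (suc p) x (y ∷ ys) (x<y ∷ x<ys) (s≤s p≤) = begin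
    count< y (insertAt p x ys) + invs (insertAt p x ys)
      ≡⟨ ≡.cong₂ _+_ (count<-insertAt p ys x<y) (invs-insertAt p x ys x<ys p≤) ⟩
    suc (count< y ys + (p + invs ys))  ≡⟨ ≡.cong suc (ℕP.+-assoc (count< y ys) p (invs ys)) ⟨
    suc (count< y ys + p + invs ys)    ≡⟨ ≡.cong (λ k → suc (k + invs ys)) (ℕP.+-comm (count< y ys) p) ⟩
    suc (p + count< y ys + invs ys)    ≡⟨ ≡.cong suc (ℕP.+-assoc p (count< y ys) (invs ys)) ⟩
    suc p + invs (y ∷ ys)              ∎

  -- The first a entries obey w₁, the remaining ones obey w₂, and the two blocks are not compared.
  joinAt : ℕ → Word → Word → Word
  joinAt zero w₁ w₂ = w₂
  joinAt (suc zero) w₁ w₂ = free ◂ w₂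
  joinAt (suc (suc a)) w₁ w₂ = w₁ 0 ◂ joinAt (suc a) (w₁ ∘ suc) w₂

  insertable-joinAt-left : ∀ {p a} b w₁ w₂ → p ≤ a → insertable (joinAt (suc a) w₁ w₂) p (a + b) ≡ insertable w₁ p a
  insertable-joinAt-left {zero} {zero} zero w₁ w₂ _ = refl
  insertable-joinAt-left {zero} {zero} (suc b) w₁ w₂ _ = refl
  insertable-joinAt-left {zero} {suc a} b w₁ w₂ _ = refl
  insertable-joinAt-left {suc zero} {suc a} b w₁ w₂ _ =
    ≡.cong (allowsDescent (w₁ 0) ∧_) (insertable-joinAt-left {a = a} b (w₁ ∘ suc) w₂ z≤n)
  insertable-joinAt-left {suc (suc p)} {suc a} b w₁ w₂ (s≤s p<a) = insertable-joinAt-left b (w₁ ∘ suc) w₂ p<a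

  insertable-joinAt-right : ∀ a {i b} w₁ w₂ → insertable (joinAt (suc a) w₁ w₂) (suc a + i) (a + suc b) ≡ insertable w₂ i b
  insertable-joinAt-right zero {zero} w₁ w₂ = refl
  insertable-joinAt-right zero {suc i} w₁ w₂ = refl
  insertable-joinAt-right (suc a) w₁ w₂ = insertable-joinAt-right a (w₁ ∘ suc) w₂

  residual-joinAt-left : ∀ {p a} w₁ w₂ → p ≤ a → residual (joinAt (suc a) w₁ w₂) p ≗ joinAt a (residual w₁ p) w₂
  residual-joinAt-left {zero} {zero} w₁ w₂ _ i = refl
  residual-joinAt-left {zero} {suc a} w₁ w₂ _ i = refl
  residual-joinAt-left {suc zero} {suc zero} w₁ w₂ _ i = refl
  residual-joinAt-left {suc zero} {suc (suc a)} w₁ w₂ _ i = refl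
  residual-joinAt-left {suc (suc p)} {suc (suc a)} w₁ w₂ (s≤s p<a) =
    ◂-cong (w₁ 0) (residual-joinAt-left (w₁ ∘ suc) w₂ p<a)

  residual-joinAt-right : ∀ a {i} w₁ w₂ → residual (joinAt (suc a) w₁ w₂) (suc a + i) ≗ joinAt (suc a) w₁ (residual w₂ i)
  residual-joinAt-right zero {zero} w₁ w₂ j = refl
  residual-joinAt-right zero {suc i} w₁ w₂ j = refl
  residual-joinAt-right (suc a) w₁ w₂ = ◂-cong (w₁ 0) (residual-joinAt-right a (w₁ ∘ suc) w₂)

  residual-alternating-odd : ∀ j → residual alternating (suc (2 * j)) ≗ joinAt (suc (2 * j)) alternating alternating
  residual-alternating-odd zero i = refl
  residual-alternating-odd (suc j) rewrite 2*suc j = ◂-cong descent (◂-cong ascent (residual-alternating-odd j))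

  insertable-alternating-odd : ∀ j n → insertable alternating (suc (2 * j)) n ≡ true
  insertable-alternating-odd zero zero = refl
  insertable-alternating-odd zero (suc zero) = refl
  insertable-alternating-odd zero (suc (suc n)) = refl
  insertable-alternating-odd (suc j) n rewrite 2*suc j = insertable-alternating-odd j (pred (pred n))

  insertable-alternating-even : ∀ j n → insertable alternating (2 * j) (suc n) ≡ false
  insertable-alternating-even zero n = refl
  insertable-alternating-even (suc j) n rewrite 2*suc j = after-ascent j (suc n)
    where
    after-ascent : ∀ j n → insertable alternating (suc (suc (2 * j))) n ≡ false
    after-ascent zero n = refl
    after-ascent (suc j) n rewrite 2*suc j = after-ascent j (pred (pred n))

module AlternatingPermutations where

  open import Defs
  open import Data.Bool using (true; false; _∧_; _≟_)
  open import Data.Bool.Properties using (¬-not)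
  open import Data.List using (List; []; _∷_; length; filter; map; concatMap; upTo)
  open import Data.List.Properties using (length-upTo)
  open import Data.List.Relation.Unary.All as All using (All; []; _∷_)
  open import Data.List.Relation.Unary.All.Properties using (map⁺; concat⁺)
  open import Data.List.Relation.Unary.AllPairs using (AllPairs; []; _∷_)
  import Data.List.Relation.Unary.AllPairs.Properties as AllPairs
  open import Data.Nat using (ℕ; zero; suc; _+_; _*_; _∸_; _≤_; _<_; s≤s)
  import Data.Nat.Properties as ℕP
  open import Data.Product using (_,_)
  open import Function using (_∘_; id)
  open import Relation.Binary.PropositionalEquality as ≡ using (_≡_; refl; _≗_)
  open import Relation.Nullary using (yes; no)

  open Arithmetic
  open ConstraintWords
  open QSeries
  open RingSolver seriesRing constₛ-morphism
  open import Relation.Binary.Reasoning.Setoid S.setoid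

  weight : Word → List ℕ → PS
  weight w π = [ satisfies w π ]· qpow (invs π)

  []·-∧ : ∀ a b p k → [ a ∧ b ]· qpow (p + k) ≈ₛ [ a ]· (qpow p *ₛ [ b ]· qpow k)
  []·-∧ true true p k = qpow-+ p k
  []·-∧ true false p k = S.sym (S.zeroʳ (qpow p))
  []·-∧ false b p k = S.refl

  weight-insertAt : ∀ w p x σ → All (x <_) σ → p ≤ length σ →
    weight w (insertAt p x σ) ≈ₛ [ insertable w p (length σ) ]· (qpow p *ₛ weight (residual w p) σ)
  weight-insertAt w p x σ x<σ p≤ =
    S.trans (S.reflexive (≡.cong₂ [_]·_ (satisfies-insertAt w p x σ x<σ p≤) (≡.cong qpow (invs-insertAt p x σ x<σ p≤))))
            ([]·-∧ (insertable w p (length σ)) (satisfies (residual w p) σ) p (invs σ))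

  ΣL-insertAll : ∀ (f : List ℕ → PS) x σ → ΣL f (insertAll x σ) ≈ₛ Σ (suc (length σ)) (λ p → f (insertAt p x σ))
  ΣL-insertAll f x [] = S.+-comm (f (x ∷ [])) 0ₛ
  ΣL-insertAll f x (y ∷ ys) = begin
    f (x ∷ y ∷ ys) +ₛ ΣL f (map (y ∷_) (insertAll x ys))
      ≈⟨ S.+-congˡ {f (x ∷ y ∷ ys)} (S.reflexive (ΣL-map f (y ∷_) (insertAll x ys))) ⟩
    f (x ∷ y ∷ ys) +ₛ ΣL (f ∘ (y ∷_)) (insertAll x ys)
      ≈⟨ S.+-congˡ {f (x ∷ y ∷ ys)} (ΣL-insertAll (f ∘ (y ∷_)) x ys) ⟩
    f (x ∷ y ∷ ys) +ₛ Σ (suc (length ys)) (λ p → f (y ∷ insertAt p x ys))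
      ≈⟨ Σ-head (suc (length ys)) (λ p → f (insertAt p x (y ∷ ys))) ⟨
    Σ (suc (suc (length ys))) (λ p → f (insertAt p x (y ∷ ys))) ∎

  insertAll-All : ∀ {P : ℕ → Set} {x} σ → P x → All P σ → All (All P) (insertAll x σ)
  insertAll-All [] px [] = (px ∷ []) ∷ []
  insertAll-All (y ∷ ys) px (py ∷ pys) = (px ∷ py ∷ pys) ∷ map⁺ (All.map (py ∷_) (insertAll-All ys px pys))

  insertAll-length : ∀ x σ → All (λ π → length π ≡ suc (length σ)) (insertAll x σ)
  insertAll-length x [] = refl ∷ []
  insertAll-length x (y ∷ ys) = refl ∷ map⁺ (All.map (≡.cong suc) (insertAll-length x ys))

  perms-All : ∀ {P : ℕ → Set} {xs} → All P xs → All (All P) (perms xs)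
  perms-All [] = [] ∷ []
  perms-All {xs = x ∷ xs} (px ∷ pxs) = concat⁺ (map⁺ (All.map (λ {σ} → insertAll-All σ px) (perms-All pxs)))

  perms-length : ∀ xs → All (λ σ → length σ ≡ length xs) (perms xs)
  perms-length [] = refl ∷ []
  perms-length (x ∷ xs) =
    concat⁺ (map⁺ (All.map (λ {σ} σ≡ → All.map (λ π≡ → ≡.trans π≡ (≡.cong suc σ≡)) (insertAll-length x σ)) (perms-length xs)))

  permGF : ℕ → Word → PS
  permGF zero w = 1ₛ
  permGF (suc n) w = Σ (suc n) (λ p → [ insertable w p n ]· (qpow p *ₛ permGF n (residual w p)))

  insertionTerm : Word → ℕ → ℕ → PS
  insertionTerm w n p = [ insertable w p n ]· (qpow p *ₛ permGF n (residual w p))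

  permGF-cong : ∀ n {w w′} → w ≗ w′ → permGF n w ≈ₛ permGF n w′
  permGF-cong zero e = S.refl
  permGF-cong (suc n) {w} {w′} e = Σ-cong′ (suc n) λ p →
    S.trans (S.reflexive (≡.cong (λ b → [ b ]· (qpow p *ₛ permGF n (residual w p))) (insertable-cong e p n)))
            ([]·-cong (insertable w′ p n) (S.*-congˡ {qpow p} (permGF-cong n (residual-cong e p))))

  -- Inserting the least entry into the permutations of the others gives the recursion defining permGF.
  ΣL-weight-perms : ∀ {l} → AllPairs _<_ l → ∀ w → ΣL (weight w) (perms l) ≈ₛ permGF (length l) w
  ΣL-weight-perms [] w = S.trans (S.+-identityʳ (qpow 0)) qpow-0
  ΣL-weight-perms {x ∷ xs} (x<xs ∷ sorted) w = begin
    ΣL (weight w) (concatMap (insertAll x) (perms xs))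
      ≈⟨ ΣL-concatMap (weight w) (insertAll x) (perms xs) ⟩
    ΣL (λ σ → ΣL (weight w) (insertAll x σ)) (perms xs)
      ≈⟨ ΣL-cong′ (perms xs) (ΣL-insertAll (weight w) x) ⟩
    ΣL (λ σ → Σ (suc (length σ)) (λ p → weight w (insertAt p x σ))) (perms xs)
      ≈⟨ ΣL-cong (All.zipWith (λ (σ≡ , x<σ) → insert-terms σ≡ x<σ) (perms-length xs , perms-All x<xs)) ⟩
    ΣL (λ σ → Σ (suc n) (λ p → term p σ)) (perms xs)
      ≈⟨ ΣL-Σ-comm (suc n) term (perms xs) ⟩
    Σ (suc n) (λ p → ΣL (term p) (perms xs))
      ≈⟨ Σ-cong′ (suc n) (λ p → S.trans (ΣL-[]· (insertable w p n) (λ σ → qpow p *ₛ weight (residual w p) σ) (perms xs))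
           ([]·-cong (insertable w p n) (S.trans (S.sym (*-distribˡ-ΣL (qpow p) (weight (residual w p)) (perms xs)))
                                                 (S.*-congˡ {qpow p} (ΣL-weight-perms sorted (residual w p)))))) ⟩
    permGF (suc n) w ∎
    where
    n : ℕ
    n = length xs
    term : ℕ → List ℕ → PS
    term p σ = [ insertable w p n ]· (qpow p *ₛ weight (residual w p) σ)
    insert-terms : ∀ {σ} → length σ ≡ n → All (x <_) σ →
      Σ (suc (length σ)) (λ p → weight w (insertAt p x σ)) ≈ₛ Σ (suc n) (λ p → term p σ)
    insert-terms {σ} σ≡n x<σ rewrite σ≡n = Σ-cong (suc n) (λ p p≤n →
      S.trans (weight-insertAt w p x σ x<σ (≡.subst (p ≤_) (≡.sym σ≡n) (ℕP.≤-pred p≤n)))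
              (S.reflexive (≡.cong (λ k → [ insertable w p k ]· (qpow p *ₛ weight (residual w p) σ)) σ≡n)))

  foldr-filter-downUp : ∀ πs → Data.List.foldr (λ π acc → qpow (invs π) ⊕ acc) 0PS (filter (λ π → downUp π ≟ true) πs)
                               ≈ₛ ΣL (weight alternating) πs
  foldr-filter-downUp [] = S.refl
  foldr-filter-downUp (π ∷ πs) with downUp π ≟ true
  ... | yes du = S.+-cong (S.reflexive (≡.cong ([_]· qpow (invs π)) (≡.sym (≡.trans (≡.sym (altFrom≡satisfies π)) du))))
                          (foldr-filter-downUp πs)
  ... | no ¬du = S.trans (foldr-filter-downUp πs) (S.sym (S.trans
                   (S.+-congʳ {ΣL (weight alternating) πs} (S.reflexive (≡.cong ([_]· qpow (invs π)) (≡.trans (≡.sym (altFrom≡satisfies π)) (¬-not ¬du)))))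
                   (S.+-identityˡ _)))

  Tq≈permGF : ∀ n → Tq n ≈ₛ permGF n alternating
  Tq≈permGF n = begin
    Tq n                                                  ≈⟨ foldr-filter-downUp (perms (upTo n)) ⟩
    ΣL (weight alternating) (perms (upTo n))              ≈⟨ ΣL-weight-perms (AllPairs.applyUpTo⁺₁ id n (λ i<j _ → i<j)) alternating ⟩
    permGF (length (upTo n)) alternating                  ≡⟨ ≡.cong (λ k → permGF k alternating) (length-upTo n) ⟩
    permGF n alternating                                  ∎
    where import Data.List

  insertions-left : ∀ a b w₁ w₂ →
    (∀ v → permGF (a + b) (joinAt a v w₂) ≈ₛ qPascal (a + b) a *ₛ permGF a v *ₛ permGF b w₂) →
    Σ (suc a) (insertionTerm (joinAt (suc a) w₁ w₂) (a + b)) ≈ₛ qPascal (a + b) a *ₛ permGF (suc a) w₁ *ₛ permGF b w₂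
  insertions-left a b w₁ w₂ shuffle-a-b = begin
    Σ (suc a) (insertionTerm w (a + b))                            ≈⟨ Σ-cong (suc a) (λ p p≤a → term (ℕP.≤-pred p≤a)) ⟩
    Σ (suc a) (λ p → x *ₛ insertionTerm w₁ a p *ₛ F₂)               ≈⟨ *-distribʳ-Σ (suc a) F₂ (λ p → x *ₛ insertionTerm w₁ a p) ⟨
    Σ (suc a) (λ p → x *ₛ insertionTerm w₁ a p) *ₛ F₂               ≈⟨ S.*-congʳ {F₂} (*-distribˡ-Σ (suc a) x (insertionTerm w₁ a)) ⟨
    x *ₛ permGF (suc a) w₁ *ₛ F₂                                     ∎
    where
    w : Word
    x F₂ : PS
    w = joinAt (suc a) w₁ w₂
    x = qPascal (a + b) a
    F₂ = permGF b w₂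
    term : ∀ {p} → p ≤ a → insertionTerm w (a + b) p ≈ₛ x *ₛ insertionTerm w₁ a p *ₛ F₂
    term {p} p≤a = begin
      [ insertable w p (a + b) ]· (qpow p *ₛ permGF (a + b) (residual w p))
        ≡⟨ ≡.cong (λ c → [ c ]· (qpow p *ₛ permGF (a + b) (residual w p))) (insertable-joinAt-left b w₁ w₂ p≤a) ⟩
      [ insertable w₁ p a ]· (qpow p *ₛ permGF (a + b) (residual w p))
        ≈⟨ []·-cong (insertable w₁ p a) (S.*-congˡ {qpow p}
             (S.trans (permGF-cong (a + b) (residual-joinAt-left w₁ w₂ p≤a)) (shuffle-a-b (residual w₁ p)))) ⟩
      [ insertable w₁ p a ]· (qpow p *ₛ (x *ₛ F₁ *ₛ F₂))
        ≈⟨ []·-cong (insertable w₁ p a) (solve 4 (λ u x F G → u :* (x :* F :* G) := (x :* G) :* (u :* F)) S.refl (qpow p) x F₁ F₂) ⟩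
      [ insertable w₁ p a ]· ((x *ₛ F₂) *ₛ (qpow p *ₛ F₁))     ≈⟨ []·-*ˡ (insertable w₁ p a) (x *ₛ F₂) (qpow p *ₛ F₁) ⟩
      (x *ₛ F₂) *ₛ insertionTerm w₁ a p                       ≈⟨ solve 3 (λ x G t → (x :* G) :* t := x :* t :* G) S.refl x F₂ (insertionTerm w₁ a p) ⟩
      x *ₛ insertionTerm w₁ a p *ₛ F₂                         ∎
      where
      F₁ : PS
      F₁ = permGF a (residual w₁ p)

  insertions-right : ∀ a b w₁ w₂ →
    (∀ v → permGF (suc a + b) (joinAt (suc a) w₁ v) ≈ₛ qPascal (suc a + b) (suc a) *ₛ permGF (suc a) w₁ *ₛ permGF b v) →
    Σ (suc b) (λ i → insertionTerm (joinAt (suc a) w₁ w₂) (a + suc b) (suc a + i))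
      ≈ₛ qpow (suc a) *ₛ qPascal (a + suc b) (suc a) *ₛ permGF (suc a) w₁ *ₛ permGF (suc b) w₂
  insertions-right a b w₁ w₂ shuffle-1+a-b = begin
    Σ (suc b) (λ i → insertionTerm w N (suc a + i))       ≈⟨ Σ-cong′ (suc b) term ⟩
    Σ (suc b) (λ i → c *ₛ insertionTerm w₂ b i)           ≈⟨ *-distribˡ-Σ (suc b) c (insertionTerm w₂ b) ⟨
    c *ₛ permGF (suc b) w₂                                ∎
    where
    N : ℕ
    w : Word
    F₁ c : PS
    N = a + suc b
    w = joinAt (suc a) w₁ w₂
    F₁ = permGF (suc a) w₁
    c = qpow (suc a) *ₛ qPascal N (suc a) *ₛ F₁
    1+a+b≡N : suc a + b ≡ N
    1+a+b≡N = ≡.sym (ℕP.+-suc a b)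
    term : ∀ i → insertionTerm w N (suc a + i) ≈ₛ c *ₛ insertionTerm w₂ b i
    term i = begin
      [ insertable w (suc a + i) N ]· (qpow (suc a + i) *ₛ permGF N (residual w (suc a + i)))
        ≡⟨ ≡.cong (λ d → [ d ]· (qpow (suc a + i) *ₛ permGF N (residual w (suc a + i)))) (insertable-joinAt-right a w₁ w₂) ⟩
      [ insertable w₂ i b ]· (qpow (suc a + i) *ₛ permGF N (residual w (suc a + i)))
        ≈⟨ []·-cong (insertable w₂ i b) (S.*-cong (qpow-+ (suc a) i) (begin
             permGF N (residual w (suc a + i))                          ≈⟨ permGF-cong N (residual-joinAt-right a w₁ w₂) ⟩
             permGF N (joinAt (suc a) w₁ (residual w₂ i))               ≡⟨ ≡.cong (λ k → permGF k (joinAt (suc a) w₁ (residual w₂ i))) 1+a+b≡N ⟨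
             permGF (suc a + b) (joinAt (suc a) w₁ (residual w₂ i))     ≈⟨ shuffle-1+a-b (residual w₂ i) ⟩
             qPascal (suc a + b) (suc a) *ₛ F₁ *ₛ F₂                    ≡⟨ ≡.cong (λ k → qPascal k (suc a) *ₛ F₁ *ₛ F₂) 1+a+b≡N ⟩
             qPascal N (suc a) *ₛ F₁ *ₛ F₂                              ∎)) ⟩
      [ insertable w₂ i b ]· (qpow (suc a) *ₛ qpow i *ₛ (qPascal N (suc a) *ₛ F₁ *ₛ F₂))
        ≈⟨ []·-cong (insertable w₂ i b) (solve 5 (λ u v x F G → u :* v :* (x :* F :* G) := (u :* x :* F) :* (v :* G)) S.refl
             (qpow (suc a)) (qpow i) (qPascal N (suc a)) F₁ F₂) ⟩
      [ insertable w₂ i b ]· (c *ₛ (qpow i *ₛ F₂))             ≈⟨ []·-*ˡ (insertable w₂ i b) c (qpow i *ₛ F₂) ⟩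
      c *ₛ insertionTerm w₂ b i                               ∎
      where
      F₂ : PS
      F₂ = permGF b (residual w₂ i)

  -- Choosing which a of the a + b values go to the left block accounts for the factor qPascal (a + b) a.
  shuffle : ∀ a b w₁ w₂ → permGF (a + b) (joinAt a w₁ w₂) ≈ₛ qPascal (a + b) a *ₛ permGF a w₁ *ₛ permGF b w₂
  shuffle zero b w₁ w₂ = S.sym (S.trans (S.*-congʳ {permGF b w₂} (S.*-identityˡ 1ₛ)) (S.*-identityˡ (permGF b w₂)))
  shuffle (suc a) b w₁ w₂ = begin
    Σ (suc a + b) (insertionTerm w (a + b))                                         ≈⟨ Σ-+-split (suc a) b (insertionTerm w (a + b)) ⟩
    Σ (suc a) (insertionTerm w (a + b)) +ₛ Σ b (λ i → insertionTerm w (a + b) (suc a + i))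
      ≈⟨ S.+-cong (insertions-left a b w₁ w₂ (λ v → shuffle a b v w₂)) (insertions-after-left b w₂) ⟩
    x *ₛ F₁ *ₛ permGF b w₂ +ₛ qpow (suc a) *ₛ y *ₛ F₁ *ₛ permGF b w₂
      ≈⟨ solve 5 (λ x y u F₁ F₂ → x :* F₁ :* F₂ :+ u :* y :* F₁ :* F₂ := (x :+ u :* y) :* F₁ :* F₂) S.refl x y (qpow (suc a)) F₁ (permGF b w₂) ⟩
    qPascal (suc a + b) (suc a) *ₛ F₁ *ₛ permGF b w₂                                 ∎
    where
    w : Word
    x y F₁ : PS
    w = joinAt (suc a) w₁ w₂
    x = qPascal (a + b) a
    y = qPascal (a + b) (suc a)
    F₁ = permGF (suc a) w₁
    insertions-after-left : ∀ k v → Σ k (λ i → insertionTerm (joinAt (suc a) w₁ v) (a + k) (suc a + i))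
                                      ≈ₛ qpow (suc a) *ₛ qPascal (a + k) (suc a) *ₛ F₁ *ₛ permGF k v
    insertions-after-left zero v = S.sym (begin
      qpow (suc a) *ₛ qPascal (a + 0) (suc a) *ₛ F₁ *ₛ 1ₛ
        ≈⟨ S.*-congʳ {1ₛ} (S.*-congʳ {F₁} (S.*-congˡ {qpow (suc a)} (qPascal-beyond (s≤s (ℕP.≤-reflexive (ℕP.+-identityʳ a)))))) ⟩
      qpow (suc a) *ₛ 0ₛ *ₛ F₁ *ₛ 1ₛ
        ≈⟨ S.trans (S.*-identityʳ _) (S.trans (S.*-congʳ {F₁} (S.zeroʳ (qpow (suc a)))) (S.zeroˡ F₁)) ⟩
      0ₛ ∎)
    insertions-after-left (suc k) v = insertions-right a k w₁ v (shuffle (suc a) k w₁)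

  permGF-residual-alternating-odd : ∀ {m j} → j < m →
    permGF (2 * m) (residual alternating (suc (2 * j))) ≈ₛ qPascal (2 * m) (suc (2 * j)) *ₛ Tq (suc (2 * j)) *ₛ Tq (suc (2 * (m ∸ suc j)))
  permGF-residual-alternating-odd {m} {j} j<m = begin
    permGF n (residual alternating p)                      ≈⟨ permGF-cong n (residual-alternating-odd j) ⟩
    permGF n (joinAt p alternating alternating)            ≡⟨ ≡.cong (λ k → permGF k (joinAt p alternating alternating)) p+r≡n ⟨
    permGF (p + r) (joinAt p alternating alternating)      ≈⟨ shuffle p r alternating alternating ⟩
    qPascal (p + r) p *ₛ permGF p alternating *ₛ permGF r alternating
      ≈⟨ S.*-cong (S.*-cong (S.reflexive (≡.cong (λ k → qPascal k p) p+r≡n)) (S.sym (Tq≈permGF p))) (S.sym (Tq≈permGF r)) ⟩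
    qPascal n p *ₛ Tq p *ₛ Tq r                            ∎
    where
    n p r : ℕ
    n = 2 * m
    p = suc (2 * j)
    r = suc (2 * (m ∸ suc j))
    p+r≡n : p + r ≡ n
    p+r≡n = ≡.trans (≡.cong (p +_) (≡.sym (2m∸[1+2j]≡1+2[m∸[1+j]] j<m)))
                    (ℕP.m+[n∸m]≡n (ℕP.<⇒≤ (≡.subst (_≤ n) (2*suc j) (ℕP.*-monoʳ-≤ 2 j<m))))

  Tq-recurrence : ∀ m → 1 ≤ m → Tq (suc (2 * m)) ≈ₛ
    Σ m (λ j → qpow (suc (2 * j)) *ₛ (qPascal (2 * m) (suc (2 * j)) *ₛ Tq (suc (2 * j)) *ₛ Tq (suc (2 * (m ∸ suc j)))))
  Tq-recurrence m@(suc _) _ = begin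
    Tq (suc n)                                              ≈⟨ Tq≈permGF (suc n) ⟩
    Σ n term +ₛ term n                                      ≈⟨ S.+-cong (Σ-even-odd m term) (term-even m) ⟩
    Σ m (λ j → term (2 * j) +ₛ term (suc (2 * j))) +ₛ 0ₛ    ≈⟨ S.+-identityʳ _ ⟩
    Σ m (λ j → term (2 * j) +ₛ term (suc (2 * j)))
      ≈⟨ Σ-cong m (λ j j<m → S.trans (S.+-congʳ {term (suc (2 * j))} (term-even j)) (S.trans (S.+-identityˡ _) (term-odd j j<m))) ⟩
    Σ m (λ j → qpow (suc (2 * j)) *ₛ (qPascal n (suc (2 * j)) *ₛ Tq (suc (2 * j)) *ₛ Tq (suc (2 * (m ∸ suc j))))) ∎
    where
    n : ℕ
    n = 2 * m
    term : ℕ → PS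
    term = insertionTerm alternating n
    term-even : ∀ j → term (2 * j) ≈ₛ 0ₛ
    term-even j = S.reflexive (≡.cong (λ b → [ b ]· (qpow (2 * j) *ₛ permGF n (residual alternating (2 * j))))
                                      (insertable-alternating-even j _))
    term-odd : ∀ j → j < m → term (suc (2 * j)) ≈ₛ qpow (suc (2 * j)) *ₛ (qPascal n (suc (2 * j)) *ₛ Tq (suc (2 * j)) *ₛ Tq (suc (2 * (m ∸ suc j))))
    term-odd j j<m = S.trans (S.reflexive (≡.cong (λ b → [ b ]· (qpow (suc (2 * j)) *ₛ permGF n (residual alternating (suc (2 * j)))))
                                                    (insertable-alternating-odd j n)))
                             (S.*-congˡ {qpow (suc (2 * j))} (permGF-residual-alternating-odd j<m))

module QTangentCoefficients where

  open import Defs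
  open import Algebra.Solver.Ring.AlmostCommutativeRing using (_-Raw-AlmostCommutative⟶_)
  open import Data.Integer using (+_; -_)
  import Data.Integer.Properties as ℤP
  open import Data.Nat using (ℕ; zero; suc; _+_; _*_; _∸_; _≤_; _<_; s≤s)
  import Data.Nat.Properties as ℕP
  open import Relation.Binary.PropositionalEquality as ≡ using (_≡_)

  open Arithmetic
  open QSeries
  open AlternatingPermutations using (Tq-recurrence)
  open RingSolver seriesRing constₛ-morphism
  open import Relation.Binary.Reasoning.Setoid S.setoid

  tanCoeff : ℕ → PS
  tanCoeff k = Tq (suc (2 * k)) *ₛ qPoch⁻¹ (suc (2 * k))

  sgnₛ : ℕ → PS
  sgnₛ k = constₛ (sgn k)

  sgnₛ-+ : ∀ a b → sgnₛ a *ₛ sgnₛ b ≈ₛ sgnₛ (a + b)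
  sgnₛ-+ a b = S.sym (S.trans (S.reflexive (≡.cong constₛ (ℤP.^-distribˡ-+-* (- + 1) a b)))
                              (_-Raw-AlmostCommutative⟶_.*-homo constₛ-morphism (sgn a) (sgn b)))

  sgnₛ-suc : ∀ k → sgnₛ (suc k) ≈ₛ -ₛ sgnₛ k
  sgnₛ-suc k = S.trans (S.reflexive (≡.cong constₛ (ℤP.-1*i≡-i (sgn k)))) (_-Raw-AlmostCommutative⟶_.-‿homo constₛ-morphism (sgn k))

  sgnₛ-split : ∀ {j k} → j ≤ k → sgnₛ j *ₛ sgnₛ (k ∸ j) ≈ₛ sgnₛ k
  sgnₛ-split {j} {k} j≤k = S.trans (sgnₛ-+ j (k ∸ j)) (S.reflexive (≡.cong sgnₛ (ℕP.m+[n∸m]≡n j≤k)))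

  qPascal-tanCoeff : ∀ {m j} → j < m →
    qPoch⁻¹ (2 * m) *ₛ (qPascal (2 * m) (suc (2 * j)) *ₛ Tq (suc (2 * j)) *ₛ Tq (suc (2 * (m ∸ suc j))))
      ≈ₛ tanCoeff j *ₛ tanCoeff (m ∸ suc j)
  qPascal-tanCoeff {m} {j} j<m = begin
    I *ₛ (qPascal (2 * m) s *ₛ Tₛ *ₛ Tᵣ)     ≈⟨ S.*-congˡ {I} (S.*-congʳ {Tᵣ} (S.*-congʳ {Tₛ} qPascal≈)) ⟩
    I *ₛ (P *ₛ Iᵣ *ₛ Iₛ *ₛ Tₛ *ₛ Tᵣ)
      ≈⟨ solve 6 (λ I P Iᵣ Iₛ Tₛ Tᵣ → I :* (P :* Iᵣ :* Iₛ :* Tₛ :* Tᵣ) := (P :* I) :* ((Tₛ :* Iₛ) :* (Tᵣ :* Iᵣ))) S.refl I P Iᵣ Iₛ Tₛ Tᵣ ⟩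
    (P *ₛ I) *ₛ (tanCoeff j *ₛ tanCoeff (m ∸ suc j))   ≈⟨ S.*-congʳ {tanCoeff j *ₛ tanCoeff (m ∸ suc j)} (qPoch-*-qPoch⁻¹ (2 * m)) ⟩
    1ₛ *ₛ (tanCoeff j *ₛ tanCoeff (m ∸ suc j))         ≈⟨ S.*-identityˡ _ ⟩
    tanCoeff j *ₛ tanCoeff (m ∸ suc j)                 ∎
    where
    s r : ℕ
    I P Iᵣ Iₛ Tₛ Tᵣ : PS
    s = suc (2 * j)
    r = suc (2 * (m ∸ suc j))
    I = qPoch⁻¹ (2 * m)
    P = qPoch (2 * m)
    Iᵣ = qPoch⁻¹ r
    Iₛ = qPoch⁻¹ s
    Tₛ = Tq s
    Tᵣ = Tq r
    qPascal≈ : qPascal (2 * m) s ≈ₛ P *ₛ Iᵣ *ₛ Iₛ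
    qPascal≈ = S.trans (qPascal≈qPoch-quotient (ℕP.<⇒≤ (≡.subst (_≤ 2 * m) (2*suc j) (ℕP.*-monoʳ-≤ 2 j<m))))
                       (S.reflexive (≡.cong (λ k → P *ₛ qPoch⁻¹ k *ₛ Iₛ) (2m∸[1+2j]≡1+2[m∸[1+j]] j<m)))

  tanCoeff-recurrence : ∀ m → 1 ≤ m →
    1-q^ (suc (2 * m)) *ₛ tanCoeff m ≈ₛ Σ m (λ j → qpow (suc (2 * j)) *ₛ (tanCoeff j *ₛ tanCoeff (m ∸ suc j)))
  tanCoeff-recurrence m 1≤m = begin
    o *ₛ (T *ₛ qPoch⁻¹ (suc (2 * m)))   ≈⟨ solve 3 (λ o T J → o :* (T :* J) := T :* (o :* J)) S.refl o T (qPoch⁻¹ (suc (2 * m))) ⟩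
    T *ₛ (o *ₛ qPoch⁻¹ (suc (2 * m)))   ≈⟨ S.*-cong (Tq-recurrence m 1≤m) (qPoch⁻¹-suc (2 * m)) ⟩
    Σ m term *ₛ I                       ≈⟨ *-distribʳ-Σ m I term ⟩
    Σ m (λ j → term j *ₛ I)
      ≈⟨ Σ-cong m (λ j j<m → S.trans (solve 3 (λ q Y I → (q :* Y) :* I := q :* (I :* Y)) S.refl (qpow (suc (2 * j))) (Y j) I)
                                      (S.*-congˡ {qpow (suc (2 * j))} (qPascal-tanCoeff j<m))) ⟩
    Σ m (λ j → qpow (suc (2 * j)) *ₛ (tanCoeff j *ₛ tanCoeff (m ∸ suc j))) ∎
    where
    o T I : PS
    o = 1-q^ (suc (2 * m))
    T = Tq (suc (2 * m))
    I = qPoch⁻¹ (2 * m)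
    Y : ℕ → PS
    Y j = qPascal (2 * m) (suc (2 * j)) *ₛ Tq (suc (2 * j)) *ₛ Tq (suc (2 * (m ∸ suc j)))
    term : ℕ → PS
    term j = qpow (suc (2 * j)) *ₛ Y j

  Ttilde-normalised : ∀ k → Ttilde (suc k) *ₛ qPoch⁻¹ (2 * suc k) ≈ₛ Σ (suc k) (λ j → tanCoeff j *ₛ tanCoeff (k ∸ j))
  Ttilde-normalised k = begin
    Ttilde (suc k) *ₛ I                ≈⟨ S.*-congʳ {I} (sumPS≈Σ (suc k) summand) ⟩
    Σ (suc k) summand *ₛ I             ≈⟨ *-distribʳ-Σ (suc k) I summand ⟩
    Σ (suc k) (λ i → summand i *ₛ I)
      ≈⟨ Σ-cong (suc k) (λ i i≤k → S.trans (S.*-comm (summand i) I)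
                                     (S.trans (S.*-congˡ {I} (summand≈ i (ℕP.≤-pred i≤k))) (qPascal-tanCoeff i≤k))) ⟩
    Σ (suc k) (λ j → tanCoeff j *ₛ tanCoeff (k ∸ j)) ∎
    where
    I : PS
    I = qPoch⁻¹ (2 * suc k)
    summand : ℕ → PS
    summand i = qbin (2 * suc k) (2 * i + 1) ⊗ Tq (2 * i + 1) ⊗ Tq (2 * k + 1 ∸ 2 * i)
    summand≈ : ∀ i → i ≤ k → summand i ≈ₛ qPascal (2 * suc k) (suc (2 * i)) *ₛ Tq (suc (2 * i)) *ₛ Tq (suc (2 * (k ∸ i)))
    summand≈ i i≤k = begin
      summand i
        ≈⟨ ⊗³≈*ₛ (qbin (2 * suc k) (2 * i + 1)) (Tq (2 * i + 1)) (Tq (2 * k + 1 ∸ 2 * i)) ⟩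
      qbin (2 * suc k) (2 * i + 1) *ₛ Tq (2 * i + 1) *ₛ Tq (2 * k + 1 ∸ 2 * i)
        ≡⟨ ≡.cong₂ (λ a b → qbin (2 * suc k) a *ₛ Tq a *ₛ Tq b) (ℕP.+-comm (2 * i) 1)
                   (≡.trans (≡.cong (_∸ 2 * i) (ℕP.+-comm (2 * k) 1)) (1+2n∸2k≡1+2[n∸k] i≤k)) ⟩
      qbin (2 * suc k) (suc (2 * i)) *ₛ Tq (suc (2 * i)) *ₛ Tq (suc (2 * (k ∸ i)))
        ≈⟨ S.*-congʳ {Tq (suc (2 * (k ∸ i)))} (S.*-congʳ {Tq (suc (2 * i))} (qbin≈qPascal 1+2i≤2+2k)) ⟩
      qPascal (2 * suc k) (suc (2 * i)) *ₛ Tq (suc (2 * i)) *ₛ Tq (suc (2 * (k ∸ i))) ∎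
      where
      1+2i≤2+2k : suc (2 * i) ≤ 2 * suc k
      1+2i≤2+2k = ℕP.<⇒≤ (≡.subst (_≤ 2 * suc k) (2*suc i) (ℕP.*-monoʳ-≤ 2 (s≤s i≤k)))

  Tq-1 : Tq 1 ≈ₛ 1ₛ
  Tq-1 = pw λ { zero → ≡.refl ; (suc d) → ≡.refl }

  tanCoeff-initial : 1-q^ 1 *ₛ tanCoeff 0 ≈ₛ 1ₛ
  tanCoeff-initial = begin
    1-q^ 1 *ₛ (Tq 1 *ₛ qPoch⁻¹ 1)     ≈⟨ solve 3 (λ o T J → o :* (T :* J) := T :* (o :* J)) S.refl (1-q^ 1) (Tq 1) (qPoch⁻¹ 1) ⟩
    Tq 1 *ₛ (1-q^ 1 *ₛ qPoch⁻¹ 1)     ≈⟨ S.*-cong Tq-1 (S.trans (qPoch⁻¹-suc 0) qPoch⁻¹-0) ⟩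
    1ₛ *ₛ 1ₛ                          ≈⟨ S.*-identityˡ 1ₛ ⟩
    1ₛ                                ∎

module QTangentSeries where

  open import Defs
  open import Algebra.Solver.Ring.AlmostCommutativeRing using (_-Raw-AlmostCommutative⟶_)
  open import Data.Integer using (+_)
  open import Data.Nat using (ℕ; zero; suc; _+_; _*_; _∸_; _≤_; z≤n; s≤s)
  import Data.Nat.Properties as ℕP
  open import Function using (_∘_)
  open import Relation.Binary.PropositionalEquality as ≡ using (_≡_; refl)

  open Arithmetic
  open QSeries
  open QTangentCoefficients
  open RingSolver seriesRing constₛ-morphism
  open import Relation.Binary.Reasoning.Setoid S.setoid

  -- Power series in x with coefficients in ℤ[[q]].
  module 𝕏 = PowerSeries seriesRing constₛ-morphism
  open 𝕏 public using ()
    renaming ( Series to Seriesˣ; _≐_ to _≐ˣ_; _≈ₛ_ to infix 4 _≋_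
             ; _+ₛ_ to infixl 6 _⊞_; _*ₛ_ to infixl 7 _⊠_; -ₛ_ to infix 8 ⊟_; 0ₛ to 𝟎; 1ₛ to 𝟏; X to x)

  oddSeries evenSeries : (ℕ → PS) → Seriesˣ
  oddSeries a zero = 0ₛ
  oddSeries a (suc zero) = a 0
  oddSeries a (suc (suc n)) = oddSeries (a ∘ suc) n
  evenSeries a zero = a 0
  evenSeries a (suc zero) = 0ₛ
  evenSeries a (suc (suc n)) = evenSeries (a ∘ suc) n

  oddSeries-at-even : ∀ a k → oddSeries a (2 * k) ≡ 0ₛ
  oddSeries-at-even a zero = refl
  oddSeries-at-even a (suc k) = ≡.trans (≡.cong (oddSeries a) (2*suc k)) (oddSeries-at-even (a ∘ suc) k)

  oddSeries-at-odd : ∀ a k → oddSeries a (suc (2 * k)) ≡ a k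
  oddSeries-at-odd a zero = refl
  oddSeries-at-odd a (suc k) = ≡.trans (≡.cong (oddSeries a ∘ suc) (2*suc k)) (oddSeries-at-odd (a ∘ suc) k)

  evenSeries-at-even : ∀ a k → evenSeries a (2 * k) ≡ a k
  evenSeries-at-even a zero = refl
  evenSeries-at-even a (suc k) = ≡.trans (≡.cong (evenSeries a) (2*suc k)) (evenSeries-at-even (a ∘ suc) k)

  evenSeries-at-odd : ∀ a k → evenSeries a (suc (2 * k)) ≡ 0ₛ
  evenSeries-at-odd a zero = refl
  evenSeries-at-odd a (suc k) = ≡.trans (≡.cong (evenSeries a ∘ suc) (2*suc k)) (evenSeries-at-odd (a ∘ suc) k)

  oddSeries-odd : ∀ a → 𝕏.OddSeries (oddSeries a)
  oddSeries-odd a k = S.reflexive (oddSeries-at-even a k)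

  open 𝕏.QDifference qpow qpow-0 qpow-+ public using (_ᵠ; D)

  -- τ is a q-analogue of tanh x = -i tan(ix). By the q-binomial theorem ρ = (1 + x) G is
  -- (-x;q)_∞/(x;q)_∞, a q-analogue of e²ˣ, and τ = (ρ - 1)/(ρ + 1); E is the even part of G and D P = E.
  τ : Seriesˣ
  τ = oddSeries (λ k → sgnₛ k *ₛ tanCoeff k)

  G : Seriesˣ
  G n = negqPoch n *ₛ qPoch⁻¹ n

  E : Seriesˣ
  E = evenSeries (λ j → G (2 * j))

  P : Seriesˣ
  P = oddSeries (λ j → negqPoch (2 * j) *ₛ qPoch⁻¹ (suc (2 * j)))

  ρ : Seriesˣ
  ρ = (𝟏 ⊞ x) ⊠ G

  G-0 : G 0 ≈ₛ 1ₛ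
  G-0 = S.trans (S.*-cong 1PS≈1ₛ qPoch⁻¹-0) (S.*-identityˡ 1ₛ)

  G-recurrence : ∀ n → 1-q^ (suc n) *ₛ G (suc n) ≈ₛ 1+q^ (suc n) *ₛ G n
  G-recurrence n = begin
    o *ₛ (negqPoch (suc n) *ₛ J)          ≈⟨ S.*-congˡ {o} (S.*-congʳ {J} (negqPoch-suc n)) ⟩
    o *ₛ ((N *ₛ 1+q^ (suc n)) *ₛ J)       ≈⟨ solve 4 (λ o N p J → o :* ((N :* p) :* J) := (p :* N) :* (o :* J)) S.refl o N (1+q^ (suc n)) J ⟩
    (1+q^ (suc n) *ₛ N) *ₛ (o *ₛ J)       ≈⟨ S.*-congˡ {1+q^ (suc n) *ₛ N} (qPoch⁻¹-suc n) ⟩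
    (1+q^ (suc n) *ₛ N) *ₛ qPoch⁻¹ n      ≈⟨ S.*-assoc (1+q^ (suc n)) N (qPoch⁻¹ n) ⟩
    1+q^ (suc n) *ₛ G n                   ∎
    where
    o N J : PS
    o = 1-q^ (suc n)
    N = negqPoch n
    J = qPoch⁻¹ (suc n)

  ρ-at-0 : ρ 0 ≈ₛ 1ₛ
  ρ-at-0 = S.trans (𝕏.[1+X]*ₛ G 0) (S.trans (S.+-congˡ {G 0} (𝕏.X*ₛ-at-0 G)) (S.trans (S.+-identityʳ (G 0)) G-0))

  ρ-at-suc : ∀ n → ρ (suc n) ≈ₛ G (suc n) +ₛ G n
  ρ-at-suc n = S.trans (𝕏.[1+X]*ₛ G (suc n)) (S.+-congˡ {G (suc n)} (𝕏.X*ₛ-at-suc G n))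

  [ρ+1]²-at-0 : ((ρ ⊞ 𝟏) ⊠ (ρ ⊞ 𝟏)) 0 ≈ₛ constₛ (+ 4)
  [ρ+1]²-at-0 = begin
    ((ρ ⊞ 𝟏) ⊠ (ρ ⊞ 𝟏)) 0          ≈⟨ 𝕏.*ₛ-at-0 (ρ ⊞ 𝟏) (ρ ⊞ 𝟏) ⟩
    (ρ 0 +ₛ 1ₛ) *ₛ (ρ 0 +ₛ 1ₛ)     ≈⟨ S.*-cong ρ₀+1≈2 ρ₀+1≈2 ⟩
    constₛ (+ 2) *ₛ constₛ (+ 2)   ≈⟨ *-homo (+ 2) (+ 2) ⟨
    constₛ (+ 4)                   ∎
    where
    open _-Raw-AlmostCommutative⟶_ constₛ-morphism using (+-homo; *-homo)
    ρ₀+1≈2 : ρ 0 +ₛ 1ₛ ≈ₛ constₛ (+ 2)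
    ρ₀+1≈2 = S.trans (S.+-congʳ {1ₛ} ρ-at-0) (S.sym (+-homo (+ 1) (+ 1)))

  [1-x]⊠-at-0 : ∀ f → ((𝟏 ⊞ ⊟ x) ⊠ f) 0 ≈ₛ f 0
  [1-x]⊠-at-0 f = S.trans (𝕏.[1-X]*ₛ f 0) (S.trans (S.+-congˡ {f 0} (S.trans (S.-‿cong (𝕏.X*ₛ-at-0 f)) -0#≈0#)) (S.+-identityʳ (f 0)))

  [1-x]⊠-at-suc : ∀ f n → ((𝟏 ⊞ ⊟ x) ⊠ f) (suc n) ≈ₛ f (suc n) +ₛ -ₛ f n
  [1-x]⊠-at-suc f n = S.trans (𝕏.[1-X]*ₛ f (suc n)) (S.+-congˡ {f (suc n)} (S.-‿cong (𝕏.X*ₛ-at-suc f n)))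

  D-ρ : D ρ ≐ˣ G ⊞ G
  D-ρ n = begin
    1-q^ (suc n) *ₛ ρ (suc n)                            ≈⟨ S.*-congˡ {1-q^ (suc n)} (ρ-at-suc n) ⟩
    1-q^ (suc n) *ₛ (G (suc n) +ₛ G n)                   ≈⟨ S.distribˡ (1-q^ (suc n)) (G (suc n)) (G n) ⟩
    1-q^ (suc n) *ₛ G (suc n) +ₛ 1-q^ (suc n) *ₛ G n     ≈⟨ S.+-congʳ {1-q^ (suc n) *ₛ G n} (G-recurrence n) ⟩
    1+q^ (suc n) *ₛ G n +ₛ 1-q^ (suc n) *ₛ G n
      ≈⟨ solve 2 (λ q G → (con (+ 1) :+ q) :* G :+ (con (+ 1) :- q) :* G := G :+ G) S.refl (qpow (suc n)) (G n) ⟩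
    G n +ₛ G n                                           ∎

  ρᵠ : ρ ᵠ ≐ˣ (𝟏 ⊞ ⊟ x) ⊠ G
  ρᵠ zero = begin
    qpow 0 *ₛ ρ 0              ≈⟨ S.*-cong qpow-0 ρ-at-0 ⟩
    1ₛ *ₛ 1ₛ                   ≈⟨ S.*-identityˡ 1ₛ ⟩
    1ₛ                         ≈⟨ S.trans ([1-x]⊠-at-0 G) G-0 ⟨
    ((𝟏 ⊞ ⊟ x) ⊠ G) 0          ∎
  ρᵠ (suc n) = begin
    u *ₛ ρ (suc n)                                  ≈⟨ S.*-congˡ {u} (ρ-at-suc n) ⟩
    u *ₛ (G (suc n) +ₛ G n)
      ≈⟨ solve 3 (λ u a b → u :* (a :+ b) := (a :- b) :- ((con (+ 1) :- u) :* a :- (con (+ 1) :+ u) :* b)) S.refl u (G (suc n)) (G n) ⟩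
    (G (suc n) +ₛ -ₛ G n) +ₛ -ₛ (1-q^ (suc n) *ₛ G (suc n) +ₛ -ₛ (1+q^ (suc n) *ₛ G n))
      ≈⟨ S.+-congˡ {G (suc n) +ₛ -ₛ G n} (S.trans (S.-‿cong (S.trans (S.+-congʳ { -ₛ (1+q^ (suc n) *ₛ G n)} (G-recurrence n))
                                                                      (S.-‿inverseʳ (1+q^ (suc n) *ₛ G n)))) -0#≈0#) ⟩
    (G (suc n) +ₛ -ₛ G n) +ₛ 0ₛ                     ≈⟨ S.trans (S.+-identityʳ _) (S.sym ([1-x]⊠-at-suc G n)) ⟩
    ((𝟏 ⊞ ⊟ x) ⊠ G) (suc n)                        ∎
    where
    u : PS
    u = qpow (suc n)

  D-P : D P ≐ˣ E
  D-P n with parity n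
  ... | Even j = begin
    1-q^ (suc (2 * j)) *ₛ P (suc (2 * j))
      ≡⟨ ≡.cong (1-q^ (suc (2 * j)) *ₛ_) (oddSeries-at-odd _ j) ⟩
    1-q^ (suc (2 * j)) *ₛ (negqPoch (2 * j) *ₛ qPoch⁻¹ (suc (2 * j)))
      ≈⟨ solve 3 (λ o N J → o :* (N :* J) := N :* (o :* J)) S.refl (1-q^ (suc (2 * j))) (negqPoch (2 * j)) (qPoch⁻¹ (suc (2 * j))) ⟩
    negqPoch (2 * j) *ₛ (1-q^ (suc (2 * j)) *ₛ qPoch⁻¹ (suc (2 * j)))
      ≈⟨ S.*-congˡ {negqPoch (2 * j)} (qPoch⁻¹-suc (2 * j)) ⟩
    G (2 * j)   ≡⟨ evenSeries-at-even _ j ⟨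
    E (2 * j)   ∎
  ... | Odd j = begin
    1-q^ (suc (suc (2 * j))) *ₛ P (suc (suc (2 * j)))   ≡⟨ ≡.cong (1-q^ (suc (suc (2 * j))) *ₛ_) (oddSeries-at-even _ j) ⟩
    1-q^ (suc (suc (2 * j))) *ₛ 0ₛ              ≈⟨ S.zeroʳ (1-q^ (suc (suc (2 * j)))) ⟩
    0ₛ                                         ≡⟨ evenSeries-at-odd _ j ⟨
    E (suc (2 * j))                            ∎

  P+P+[1-x]⊠E : P ⊞ P ⊞ (𝟏 ⊞ ⊟ x) ⊠ E ≐ˣ G
  P+P+[1-x]⊠E zero = S.trans (S.+-cong (S.+-identityʳ 0ₛ) ([1-x]⊠-at-0 E)) (S.+-identityˡ (G 0))
  P+P+[1-x]⊠E (suc n) with parity n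
  ... | Even j = begin
    (P (suc (2 * j)) +ₛ P (suc (2 * j))) +ₛ ((𝟏 ⊞ ⊟ x) ⊠ E) (suc (2 * j))
      ≈⟨ S.+-cong (S.reflexive (≡.cong₂ _+ₛ_ (oddSeries-at-odd _ j) (oddSeries-at-odd _ j)))
                  (S.trans ([1-x]⊠-at-suc E (2 * j)) (S.reflexive (≡.cong₂ (λ a b → a +ₛ -ₛ b) (evenSeries-at-odd _ j) (evenSeries-at-even _ j)))) ⟩
    (N *ₛ J +ₛ N *ₛ J) +ₛ (0ₛ +ₛ -ₛ (N *ₛ qPoch⁻¹ (2 * j)))
      ≈⟨ S.+-congˡ {N *ₛ J +ₛ N *ₛ J} (S.+-congˡ {0ₛ} (S.-‿cong (S.*-congˡ {N} (S.sym (qPoch⁻¹-suc (2 * j)))))) ⟩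
    (N *ₛ J +ₛ N *ₛ J) +ₛ (0ₛ +ₛ -ₛ (N *ₛ (1-q^ (suc (2 * j)) *ₛ J)))
      ≈⟨ S.+-congˡ {N *ₛ J +ₛ N *ₛ J} (S.+-identityˡ _) ⟩
    (N *ₛ J +ₛ N *ₛ J) +ₛ -ₛ (N *ₛ (1-q^ (suc (2 * j)) *ₛ J))
      ≈⟨ solve 3 (λ N J q → (N :* J :+ N :* J) :- N :* ((con (+ 1) :- q) :* J) := (N :* (con (+ 1) :+ q)) :* J) S.refl N J (qpow (suc (2 * j))) ⟩
    (N *ₛ 1+q^ (suc (2 * j))) *ₛ J     ≈⟨ S.*-congʳ {J} (negqPoch-suc (2 * j)) ⟨
    G (suc (2 * j))                   ∎
    where
    N J : PS
    N = negqPoch (2 * j)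
    J = qPoch⁻¹ (suc (2 * j))
  ... | Odd j = begin
    (P (suc (suc (2 * j))) +ₛ P (suc (suc (2 * j)))) +ₛ ((𝟏 ⊞ ⊟ x) ⊠ E) (suc (suc (2 * j)))
      ≈⟨ S.+-cong (S.reflexive (≡.cong₂ _+ₛ_ (oddSeries-at-even _ j) (oddSeries-at-even _ j)))
                  (S.trans ([1-x]⊠-at-suc E (suc (2 * j))) (S.reflexive (≡.cong₂ (λ a b → a +ₛ -ₛ b) (evenSeries-at-even _ j) (evenSeries-at-odd _ j)))) ⟩
    (0ₛ +ₛ 0ₛ) +ₛ (G (2 * suc j) +ₛ -ₛ 0ₛ)
      ≈⟨ S.trans (S.+-identityˡ _) (S.trans (S.+-congˡ {G (2 * suc j)} -0#≈0#) (S.+-identityʳ _)) ⟩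
    G (2 * suc j)                ≡⟨ ≡.cong G (2*suc j) ⟩
    G (suc (suc (2 * j)))        ∎

  τ-odd : 𝕏.OddSeries τ
  τ-odd = oddSeries-odd _

  τᵠ-odd : 𝕏.OddSeries (τ ᵠ)
  τᵠ-odd k = S.trans (S.*-congˡ {qpow (2 * k)} (τ-odd k)) (S.zeroʳ (qpow (2 * k)))

  signed-odd-product-at-even : ∀ {f g} (a b : ℕ → PS) → 𝕏.OddSeries f → 𝕏.OddSeries g →
    (∀ k → f (suc (2 * k)) ≈ₛ sgnₛ k *ₛ a k) → (∀ k → g (suc (2 * k)) ≈ₛ sgnₛ k *ₛ b k) →
    ∀ m → (f ⊠ g) (2 * suc m) ≈ₛ sgnₛ m *ₛ Σ (suc m) (λ j → a j *ₛ b (m ∸ j))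
  signed-odd-product-at-even {f} {g} a b f-odd g-odd f≈ g≈ m = begin
    (f ⊠ g) (2 * suc m)                                          ≈⟨ 𝕏.odd*odd-at-even {f} {g} f-odd g-odd (suc m) ⟩
    Σ (suc m) (λ j → f (suc (2 * j)) *ₛ g (suc (2 * (m ∸ j))))    ≈⟨ Σ-cong (suc m) (λ j j≤m → term (ℕP.≤-pred j≤m)) ⟩
    Σ (suc m) (λ j → sgnₛ m *ₛ (a j *ₛ b (m ∸ j)))               ≈⟨ *-distribˡ-Σ (suc m) (sgnₛ m) (λ j → a j *ₛ b (m ∸ j)) ⟨
    sgnₛ m *ₛ Σ (suc m) (λ j → a j *ₛ b (m ∸ j))                 ∎
    where
    term : ∀ {j} → j ≤ m → f (suc (2 * j)) *ₛ g (suc (2 * (m ∸ j))) ≈ₛ sgnₛ m *ₛ (a j *ₛ b (m ∸ j))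
    term {j} j≤m = begin
      f (suc (2 * j)) *ₛ g (suc (2 * (m ∸ j)))                 ≈⟨ S.*-cong (f≈ j) (g≈ (m ∸ j)) ⟩
      (sgnₛ j *ₛ a j) *ₛ (sgnₛ (m ∸ j) *ₛ b (m ∸ j))
        ≈⟨ solve 4 (λ s a t b → (s :* a) :* (t :* b) := (s :* t) :* (a :* b)) S.refl (sgnₛ j) (a j) (sgnₛ (m ∸ j)) (b (m ∸ j)) ⟩
      (sgnₛ j *ₛ sgnₛ (m ∸ j)) *ₛ (a j *ₛ b (m ∸ j))          ≈⟨ S.*-congʳ {a j *ₛ b (m ∸ j)} (sgnₛ-split j≤m) ⟩
      sgnₛ m *ₛ (a j *ₛ b (m ∸ j))                             ∎

  τ-at-odd : ∀ k → τ (suc (2 * k)) ≈ₛ sgnₛ k *ₛ tanCoeff k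
  τ-at-odd k = S.reflexive (oddSeries-at-odd _ k)

  τᵠ-at-odd : ∀ k → (τ ᵠ) (suc (2 * k)) ≈ₛ sgnₛ k *ₛ (qpow (suc (2 * k)) *ₛ tanCoeff k)
  τᵠ-at-odd k = S.trans (S.*-congˡ {qpow (suc (2 * k))} (τ-at-odd k))
    (solve 3 (λ u s t → u :* (s :* t) := s :* (u :* t)) S.refl (qpow (suc (2 * k))) (sgnₛ k) (tanCoeff k))

  D-τ : D τ ≐ˣ 𝟏 ⊞ ⊟ (τ ᵠ ⊠ τ)
  D-τ n with parity n
  ... | Even zero = begin
    1-q^ 1 *ₛ (1ₛ *ₛ tanCoeff 0)  ≈⟨ S.*-congˡ {1-q^ 1} (S.*-identityˡ (tanCoeff 0)) ⟩
    1-q^ 1 *ₛ tanCoeff 0          ≈⟨ tanCoeff-initial ⟩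
    1ₛ                            ≈⟨ S.+-identityʳ 1ₛ ⟨
    1ₛ +ₛ 0ₛ                      ≈⟨ S.+-congˡ {1ₛ} (S.trans (S.-‿cong (S.trans (𝕏.*ₛ-at-0 (τ ᵠ) τ) (S.zeroʳ ((τ ᵠ) 0)))) -0#≈0#) ⟨
    1ₛ +ₛ -ₛ ((τ ᵠ ⊠ τ) 0)        ∎
  ... | Even (suc m) = begin
    1-q^ (suc (2 * suc m)) *ₛ τ (suc (2 * suc m))            ≈⟨ S.*-congˡ {1-q^ (suc (2 * suc m))} (τ-at-odd (suc m)) ⟩
    1-q^ (suc (2 * suc m)) *ₛ (sgnₛ (suc m) *ₛ tanCoeff (suc m))
      ≈⟨ solve 3 (λ o s t → o :* (s :* t) := s :* (o :* t)) S.refl (1-q^ (suc (2 * suc m))) (sgnₛ (suc m)) (tanCoeff (suc m)) ⟩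
    sgnₛ (suc m) *ₛ (1-q^ (suc (2 * suc m)) *ₛ tanCoeff (suc m))
      ≈⟨ S.*-cong (sgnₛ-suc m) (S.trans (tanCoeff-recurrence (suc m) (s≤s z≤n))
                                        (Σ-cong′ (suc m) (λ j → S.sym (S.*-assoc (qpow (suc (2 * j))) (tanCoeff j) (tanCoeff (m ∸ j)))))) ⟩
    -ₛ sgnₛ m *ₛ Sum                                           ≈⟨ S.trans (S.sym (-‿distribˡ-* (sgnₛ m) Sum)) (S.sym (S.+-identityˡ _)) ⟩
    0ₛ +ₛ -ₛ (sgnₛ m *ₛ Sum)
      ≈⟨ S.+-congˡ {0ₛ} (S.-‿cong (signed-odd-product-at-even {τ ᵠ} {τ} (λ k → qpow (suc (2 * k)) *ₛ tanCoeff k) tanCoeff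
                                                              τᵠ-odd τ-odd τᵠ-at-odd τ-at-odd m)) ⟨
    0ₛ +ₛ -ₛ ((τ ᵠ ⊠ τ) (2 * suc m))                           ∎
    where
    Sum : PS
    Sum = Σ (suc m) (λ j → qpow (suc (2 * j)) *ₛ tanCoeff j *ₛ tanCoeff (m ∸ j))
  ... | Odd m = begin
    1-q^ (suc (suc (2 * m))) *ₛ τ (suc (suc (2 * m)))   ≈⟨ S.*-congˡ {1-q^ (suc (suc (2 * m)))} (S.reflexive (oddSeries-at-even _ m)) ⟩
    1-q^ (suc (suc (2 * m))) *ₛ 0ₛ                      ≈⟨ S.zeroʳ (1-q^ (suc (suc (2 * m)))) ⟩
    0ₛ
      ≈⟨ S.trans (S.+-congˡ {0ₛ} (S.trans (S.-‿cong (𝕏.odd*odd-at-odd {τ ᵠ} {τ} τᵠ-odd τ-odd m)) -0#≈0#)) (S.+-identityʳ 0ₛ) ⟨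
    0ₛ +ₛ -ₛ ((τ ᵠ ⊠ τ) (suc (2 * m)))                  ∎

module QTangentIdentity where

  open import Defs using (qpow)
  open import Algebra
  import Algebra.Properties.Ring
  open import Data.Integer using (+_)

  open QSeries
  open QTangentSeries
  open RingSolver 𝕏.seriesRing 𝕏.constₛ-morphism
  module 𝕊 = CommutativeRing 𝕏.seriesRing
  module 𝕊P = Algebra.Properties.Ring 𝕊.ring
  open import Relation.Binary.Reasoning.Setoid 𝕊.setoid
  open 𝕏.QDifference qpow qpow-0 qpow-+ using (D-+; D-neg; D-*; D-const; ᵠ-+; ᵠ-neg; ᵠ-*; ᵠ-const; linear-solution-unique)

  D-𝟏 : D 𝟏 ≋ 𝟎
  D-𝟏 = D-const (+ 1)

  D-⊟𝟏 : D (⊟ 𝟏) ≋ 𝟎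
  D-⊟𝟏 = 𝕊.trans (D-neg 𝟏) (𝕊.trans (𝕊.-‿cong D-𝟏) 𝕊P.-0#≈0#)

  D-+-constant : ∀ f c → D c ≋ 𝟎 → D (f ⊞ c) ≋ D f
  D-+-constant f c Dc≋0 = 𝕊.trans (D-+ f c) (𝕊.trans (𝕊.+-congˡ {D f} Dc≋0) (𝕊.+-identityʳ (D f)))

  ᵠ-⊟𝟏 : (⊟ 𝟏) ᵠ ≋ ⊟ 𝟏
  ᵠ-⊟𝟏 = 𝕊.trans (ᵠ-neg 𝟏) (𝕊.-‿cong (ᵠ-const (+ 1)))

  -- u solves the linear q-difference equation D u = -τ(qx) u + u(qx) with u 0 = 0, so it vanishes.
  u : Seriesˣ
  u = τ ⊠ (ρ ⊞ 𝟏) ⊞ ⊟ (ρ ⊞ ⊟ 𝟏)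

  D-u : D u ≋ ⊟ (τ ᵠ) ⊠ u ⊞ 𝟏 ⊠ (u ᵠ)
  D-u = begin
    D u                                                            ≈⟨ D-+ (τ ⊠ (ρ ⊞ 𝟏)) (⊟ (ρ ⊞ ⊟ 𝟏)) ⟩
    D (τ ⊠ (ρ ⊞ 𝟏)) ⊞ D (⊟ (ρ ⊞ ⊟ 𝟏))                              ≈⟨ 𝕊.+-cong (D-* τ (ρ ⊞ 𝟏)) (D-neg (ρ ⊞ ⊟ 𝟏)) ⟩
    (D τ ⊠ (ρ ⊞ 𝟏) ⊞ τ ᵠ ⊠ D (ρ ⊞ 𝟏)) ⊞ ⊟ D (ρ ⊞ ⊟ 𝟏)
      ≈⟨ 𝕊.+-cong (𝕊.+-cong (𝕊.*-congʳ {ρ ⊞ 𝟏} (𝕏.pw D-τ)) (𝕊.*-congˡ {τ ᵠ} D[ρ+1]))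
                  (𝕊.-‿cong (𝕊.trans (D-+-constant ρ (⊟ 𝟏) D-⊟𝟏) (𝕏.pw D-ρ))) ⟩
    ((𝟏 ⊞ ⊟ (τ ᵠ ⊠ τ)) ⊠ (ρ ⊞ 𝟏) ⊞ τ ᵠ ⊠ (G ⊞ G)) ⊞ ⊟ (G ⊞ G)
      ≈⟨ solve 4 (λ t tq G x →
           ((con (+ 1) :- tq :* t) :* ((con (+ 1) :+ x) :* G :+ con (+ 1)) :+ tq :* (G :+ G)) :- (G :+ G)
           := (:- tq) :* (t :* ((con (+ 1) :+ x) :* G :+ con (+ 1)) :- ((con (+ 1) :+ x) :* G :- con (+ 1)))
              :+ con (+ 1) :* (tq :* ((con (+ 1) :- x) :* G :+ con (+ 1)) :- ((con (+ 1) :- x) :* G :- con (+ 1)))) 𝕊.refl τ (τ ᵠ) G x ⟩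
    ⊟ (τ ᵠ) ⊠ u ⊞ 𝟏 ⊠ (τ ᵠ ⊠ ((𝟏 ⊞ ⊟ x) ⊠ G ⊞ 𝟏) ⊞ ⊟ ((𝟏 ⊞ ⊟ x) ⊠ G ⊞ ⊟ 𝟏))
      ≈⟨ 𝕊.+-congˡ {⊟ (τ ᵠ) ⊠ u} (𝕊.*-congˡ {𝟏} uᵠ) ⟨
    ⊟ (τ ᵠ) ⊠ u ⊞ 𝟏 ⊠ (u ᵠ)                                       ∎
    where
    D[ρ+1] : D (ρ ⊞ 𝟏) ≋ G ⊞ G
    D[ρ+1] = 𝕊.trans (D-+-constant ρ 𝟏 D-𝟏) (𝕏.pw D-ρ)
    uᵠ : u ᵠ ≋ τ ᵠ ⊠ ((𝟏 ⊞ ⊟ x) ⊠ G ⊞ 𝟏) ⊞ ⊟ ((𝟏 ⊞ ⊟ x) ⊠ G ⊞ ⊟ 𝟏)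
    uᵠ = begin
      u ᵠ                                             ≈⟨ ᵠ-+ (τ ⊠ (ρ ⊞ 𝟏)) (⊟ (ρ ⊞ ⊟ 𝟏)) ⟩
      (τ ⊠ (ρ ⊞ 𝟏)) ᵠ ⊞ (⊟ (ρ ⊞ ⊟ 𝟏)) ᵠ
        ≈⟨ 𝕊.+-cong (𝕊.trans (ᵠ-* τ (ρ ⊞ 𝟏)) (𝕊.*-congˡ {τ ᵠ} (𝕊.trans (ᵠ-+ ρ 𝟏) (𝕊.+-cong (𝕏.pw ρᵠ) (ᵠ-const (+ 1))))))
                    (𝕊.trans (ᵠ-neg (ρ ⊞ ⊟ 𝟏)) (𝕊.-‿cong (𝕊.trans (ᵠ-+ ρ (⊟ 𝟏)) (𝕊.+-cong (𝕏.pw ρᵠ) ᵠ-⊟𝟏)))) ⟩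
      τ ᵠ ⊠ ((𝟏 ⊞ ⊟ x) ⊠ G ⊞ 𝟏) ⊞ ⊟ ((𝟏 ⊞ ⊟ x) ⊠ G ⊞ ⊟ 𝟏) ∎

  τ⊠[ρ+1]≋ρ-1 : τ ⊠ (ρ ⊞ 𝟏) ≋ ρ ⊞ ⊟ 𝟏
  τ⊠[ρ+1]≋ρ-1 = begin
    τ ⊠ (ρ ⊞ 𝟏)                   ≈⟨ solve 2 (λ A B → A := (A :- B) :+ B) 𝕊.refl (τ ⊠ (ρ ⊞ 𝟏)) (ρ ⊞ ⊟ 𝟏) ⟩
    u ⊞ (ρ ⊞ ⊟ 𝟏)                 ≈⟨ 𝕊.+-congʳ {ρ ⊞ ⊟ 𝟏} u≋0 ⟩
    𝟎 ⊞ (ρ ⊞ ⊟ 𝟏)                 ≈⟨ 𝕊.+-identityˡ (ρ ⊞ ⊟ 𝟏) ⟩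
    ρ ⊞ ⊟ 𝟏                       ∎
    where
    u₀≈0 : u 0 ≈ₛ 0ₛ
    u₀≈0 = S.trans (S.+-cong (S.trans (𝕏.*ₛ-at-0 τ (ρ ⊞ 𝟏)) (S.zeroˡ ((ρ ⊞ 𝟏) 0)))
                             (S.-‿cong (S.trans (S.+-congʳ { -ₛ 1ₛ} ρ-at-0) (S.-‿inverseʳ 1ₛ))))
                   (S.trans (S.+-identityˡ _) -0#≈0#)
    u≋0 : u ≋ 𝟎
    u≋0 = linear-solution-unique 1-q^suc-regular u (⊟ (τ ᵠ)) 𝟏 u₀≈0 D-u

  𝟒 : Seriesˣ
  𝟒 = 𝕏.constₛ (+ 4)

  D-𝟒⊠ : ∀ f → D (𝟒 ⊠ f) ≋ 𝟒 ⊠ D f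
  D-𝟒⊠ f = begin
    D (𝟒 ⊠ f)                    ≈⟨ D-* 𝟒 f ⟩
    D 𝟒 ⊠ f ⊞ 𝟒 ᵠ ⊠ D f          ≈⟨ 𝕊.+-cong (𝕊.trans (𝕊.*-congʳ {f} (D-const (+ 4))) (𝕊.zeroˡ f)) (𝕊.*-congʳ {D f} (ᵠ-const (+ 4))) ⟩
    𝟎 ⊞ 𝟒 ⊠ D f                  ≈⟨ 𝕊.+-identityˡ (𝟒 ⊠ D f) ⟩
    𝟒 ⊠ D f                      ∎

  -- Like u, w vanishes: D w = 0 and w 0 = 0.
  w : Seriesˣ
  w = 𝟒 ⊠ (ρ ⊠ P) ⊞ ⊟ (ρ ⊠ ρ) ⊞ 𝟏

  D-w : D w ≋ 𝟎
  D-w = begin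
    D w
      ≈⟨ 𝕊.trans (D-+-constant (𝟒 ⊠ (ρ ⊠ P) ⊞ ⊟ (ρ ⊠ ρ)) 𝟏 D-𝟏) (D-+ (𝟒 ⊠ (ρ ⊠ P)) (⊟ (ρ ⊠ ρ))) ⟩
    D (𝟒 ⊠ (ρ ⊠ P)) ⊞ D (⊟ (ρ ⊠ ρ))
      ≈⟨ 𝕊.+-cong (𝕊.trans (D-𝟒⊠ (ρ ⊠ P)) (𝕊.*-congˡ {𝟒} D[ρ⊠P])) (𝕊.trans (D-neg (ρ ⊠ ρ)) (𝕊.-‿cong D[ρ⊠ρ])) ⟩
    𝟒 ⊠ ((G ⊞ G) ⊠ P ⊞ ((𝟏 ⊞ ⊟ x) ⊠ G) ⊠ E) ⊞ ⊟ ((G ⊞ G) ⊠ ρ ⊞ ((𝟏 ⊞ ⊟ x) ⊠ G) ⊠ (G ⊞ G))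
      ≈⟨ solve 4 (λ G P E x → con (+ 4) :* ((G :+ G) :* P :+ ((con (+ 1) :- x) :* G) :* E)
                                :- ((G :+ G) :* ((con (+ 1) :+ x) :* G) :+ ((con (+ 1) :- x) :* G) :* (G :+ G))
                              := con (+ 4) :* G :* (P :+ P :+ (con (+ 1) :- x) :* E) :- con (+ 4) :* G :* G) 𝕊.refl G P E x ⟩
    𝟒 ⊠ G ⊠ (P ⊞ P ⊞ (𝟏 ⊞ ⊟ x) ⊠ E) ⊞ ⊟ (𝟒 ⊠ G ⊠ G)
      ≈⟨ 𝕊.+-congʳ {⊟ (𝟒 ⊠ G ⊠ G)} (𝕊.*-congˡ {𝟒 ⊠ G} (𝕏.pw P+P+[1-x]⊠E)) ⟩
    𝟒 ⊠ G ⊠ G ⊞ ⊟ (𝟒 ⊠ G ⊠ G)                                ≈⟨ 𝕊.-‿inverseʳ (𝟒 ⊠ G ⊠ G) ⟩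
    𝟎                                                         ∎
    where
    D[ρ⊠P] : D (ρ ⊠ P) ≋ (G ⊞ G) ⊠ P ⊞ ((𝟏 ⊞ ⊟ x) ⊠ G) ⊠ E
    D[ρ⊠P] = 𝕊.trans (D-* ρ P) (𝕊.+-cong (𝕊.*-congʳ {P} (𝕏.pw D-ρ)) (𝕊.*-cong (𝕏.pw ρᵠ) (𝕏.pw D-P)))
    D[ρ⊠ρ] : D (ρ ⊠ ρ) ≋ (G ⊞ G) ⊠ ρ ⊞ ((𝟏 ⊞ ⊟ x) ⊠ G) ⊠ (G ⊞ G)
    D[ρ⊠ρ] = 𝕊.trans (D-* ρ ρ) (𝕊.+-cong (𝕊.*-congʳ {ρ} (𝕏.pw D-ρ)) (𝕊.*-cong (𝕏.pw ρᵠ) (𝕏.pw D-ρ)))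

  ρ⊠ρ-at-0 : (ρ ⊠ ρ) 0 ≈ₛ 1ₛ
  ρ⊠ρ-at-0 = S.trans (𝕏.*ₛ-at-0 ρ ρ) (S.trans (S.*-cong ρ-at-0 ρ-at-0) (S.*-identityˡ 1ₛ))

  𝟒⊠ρ⊠P≋ρ²-1 : 𝟒 ⊠ (ρ ⊠ P) ≋ ρ ⊠ ρ ⊞ ⊟ 𝟏
  𝟒⊠ρ⊠P≋ρ²-1 = begin
    𝟒 ⊠ (ρ ⊠ P)                   ≈⟨ solve 3 (λ A B C → A := (A :- B :+ C) :+ (B :- C)) 𝕊.refl (𝟒 ⊠ (ρ ⊠ P)) (ρ ⊠ ρ) 𝟏 ⟩
    w ⊞ (ρ ⊠ ρ ⊞ ⊟ 𝟏)             ≈⟨ 𝕊.+-congʳ {ρ ⊠ ρ ⊞ ⊟ 𝟏} w≋0 ⟩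
    𝟎 ⊞ (ρ ⊠ ρ ⊞ ⊟ 𝟏)             ≈⟨ 𝕊.+-identityˡ _ ⟩
    ρ ⊠ ρ ⊞ ⊟ 𝟏                   ∎
    where
    w₀≈0 : w 0 ≈ₛ 0ₛ
    w₀≈0 = S.trans (S.+-congʳ {1ₛ} (S.+-cong 4ρP₀≈0 (S.-‿cong ρ⊠ρ-at-0)))
                   (S.trans (S.+-congʳ {1ₛ} (S.+-identityˡ (-ₛ 1ₛ))) (S.-‿inverseˡ 1ₛ))
      where
      4ρP₀≈0 : (𝟒 ⊠ (ρ ⊠ P)) 0 ≈ₛ 0ₛ
      4ρP₀≈0 = S.trans (𝕏.*ₛ-at-0 𝟒 (ρ ⊠ P)) (S.trans (S.*-congˡ {𝟒 0} (S.trans (𝕏.*ₛ-at-0 ρ P) (S.zeroʳ (ρ 0)))) (S.zeroʳ (𝟒 0)))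
    w≋0 : w ≋ 𝟎
    w≋0 = linear-solution-unique 1-q^suc-regular w 𝟎 𝟎 w₀≈0
            (𝕊.trans D-w (𝕊.sym (𝕊.trans (𝕊.+-cong (𝕊.zeroˡ w) (𝕊.zeroˡ (w ᵠ))) (𝕊.+-identityˡ 𝟎))))

  [1-τ²]⊠[ρ+1]²≋4ρ : (𝟏 ⊞ ⊟ (τ ⊠ τ)) ⊠ ((ρ ⊞ 𝟏) ⊠ (ρ ⊞ 𝟏)) ≋ 𝟒 ⊠ ρ
  [1-τ²]⊠[ρ+1]²≋4ρ = begin
    (𝟏 ⊞ ⊟ (τ ⊠ τ)) ⊠ ((ρ ⊞ 𝟏) ⊠ (ρ ⊞ 𝟏))
      ≈⟨ solve 2 (λ t R → (con (+ 1) :- t :* t) :* (R :* R) := R :* R :- (t :* R) :* (t :* R)) 𝕊.refl τ (ρ ⊞ 𝟏) ⟩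
    (ρ ⊞ 𝟏) ⊠ (ρ ⊞ 𝟏) ⊞ ⊟ ((τ ⊠ (ρ ⊞ 𝟏)) ⊠ (τ ⊠ (ρ ⊞ 𝟏)))
      ≈⟨ 𝕊.+-congˡ {(ρ ⊞ 𝟏) ⊠ (ρ ⊞ 𝟏)} (𝕊.-‿cong (𝕊.*-cong τ⊠[ρ+1]≋ρ-1 τ⊠[ρ+1]≋ρ-1)) ⟩
    (ρ ⊞ 𝟏) ⊠ (ρ ⊞ 𝟏) ⊞ ⊟ ((ρ ⊞ ⊟ 𝟏) ⊠ (ρ ⊞ ⊟ 𝟏))
      ≈⟨ solve 1 (λ r → (r :+ con (+ 1)) :* (r :+ con (+ 1)) :- (r :- con (+ 1)) :* (r :- con (+ 1)) := con (+ 4) :* r) 𝕊.refl ρ ⟩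
    𝟒 ⊠ ρ ∎

  -- Multiplying by (ρ + 1)², whose constant term 4 is regular, reduces the claim to the identities above.
  [1-τ²]⊠P≋τ : (𝟏 ⊞ ⊟ (τ ⊠ τ)) ⊠ P ≋ τ
  [1-τ²]⊠P≋τ = begin
    V ⊠ P                  ≈⟨ solve 2 (λ X t → X := (X :- t) :+ t) 𝕊.refl (V ⊠ P) τ ⟩
    Z ⊞ τ                  ≈⟨ 𝕊.+-congʳ {τ} Z≋0 ⟩
    𝟎 ⊞ τ                  ≈⟨ 𝕊.+-identityˡ τ ⟩
    τ                      ∎
    where
    V Z R : Seriesˣ
    V = 𝟏 ⊞ ⊟ (τ ⊠ τ)
    Z = V ⊠ P ⊞ ⊟ τ
    R = ρ ⊞ 𝟏
    Z⊠R²≋0 : Z ⊠ (R ⊠ R) ≋ 𝟎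
    Z⊠R²≋0 = begin
      Z ⊠ (R ⊠ R)                                  ≈⟨ solve 4 (λ V p t S → (V :* p :- t) :* S := p :* (V :* S) :- t :* S) 𝕊.refl V P τ (R ⊠ R) ⟩
      P ⊠ (V ⊠ (R ⊠ R)) ⊞ ⊟ (τ ⊠ (R ⊠ R))
        ≈⟨ 𝕊.+-cong (𝕊.*-congˡ {P} [1-τ²]⊠[ρ+1]²≋4ρ) (𝕊.-‿cong (𝕊.trans (𝕊.sym (𝕊.*-assoc τ R R)) (𝕊.*-congʳ {R} τ⊠[ρ+1]≋ρ-1))) ⟩
      P ⊠ (𝟒 ⊠ ρ) ⊞ ⊟ ((ρ ⊞ ⊟ 𝟏) ⊠ R)
        ≈⟨ solve 2 (λ r p → p :* (con (+ 4) :* r) :- (r :- con (+ 1)) :* (r :+ con (+ 1)) := con (+ 4) :* (r :* p) :- (r :* r :- con (+ 1))) 𝕊.refl ρ P ⟩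
      𝟒 ⊠ (ρ ⊠ P) ⊞ ⊟ (ρ ⊠ ρ ⊞ ⊟ 𝟏)              ≈⟨ 𝕊.+-congʳ {⊟ (ρ ⊠ ρ ⊞ ⊟ 𝟏)} 𝟒⊠ρ⊠P≋ρ²-1 ⟩
      (ρ ⊠ ρ ⊞ ⊟ 𝟏) ⊞ ⊟ (ρ ⊠ ρ ⊞ ⊟ 𝟏)            ≈⟨ 𝕊.-‿inverseʳ (ρ ⊠ ρ ⊞ ⊟ 𝟏) ⟩
      𝟎                                          ∎
    Z≋0 : Z ≋ 𝟎
    Z≋0 = 𝕏.pw (𝕏.cancel-regular (R ⊠ R) (λ y yR₀²≈0 → 4-regular y (S.trans (S.*-congˡ {y} (S.sym [ρ+1]²-at-0)) yR₀²≈0)) Z (𝕏.at Z⊠R²≋0))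

module CoefficientExtraction where

  open import Defs
  open import Data.Nat using (ℕ; zero; suc; _+_; _*_; _∸_; _≤_)
  import Data.Nat.Properties as ℕP
  open import Relation.Binary.PropositionalEquality as ≡ using (_≡_)

  open Arithmetic
  open QSeries
  open QTangentCoefficients
  open QTangentSeries
  open RingSolver seriesRing constₛ-morphism
  open import Relation.Binary.Reasoning.Setoid S.setoid

  V : Seriesˣ
  V = 𝟏 ⊞ ⊟ (τ ⊠ τ)

  V-even : 𝕏.EvenSeries V
  V-even k = S.trans (S.+-congˡ {0ₛ} (S.trans (S.-‿cong (𝕏.odd*odd-at-odd {τ} {τ} τ-odd τ-odd k)) -0#≈0#)) (S.+-identityʳ 0ₛ)

  V-at-even : ∀ k → V (2 * k) ≈ₛ sgnₛ k *ₛ Ttilde k *ₛ qPoch⁻¹ (2 * k)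
  V-at-even zero = begin
    1ₛ +ₛ -ₛ ((τ ⊠ τ) 0)             ≈⟨ S.+-congˡ {1ₛ} (S.trans (S.-‿cong (S.trans (𝕏.*ₛ-at-0 τ τ) (S.zeroˡ (τ 0)))) -0#≈0#) ⟩
    1ₛ +ₛ 0ₛ                         ≈⟨ S.+-identityʳ 1ₛ ⟩
    1ₛ                               ≈⟨ S.trans (S.*-cong (S.trans (S.*-congˡ {1ₛ} 1PS≈1ₛ) (S.*-identityˡ 1ₛ)) qPoch⁻¹-0) (S.*-identityˡ 1ₛ) ⟨
    sgnₛ 0 *ₛ Ttilde 0 *ₛ qPoch⁻¹ 0  ∎
  V-at-even (suc k) = begin
    0ₛ +ₛ -ₛ ((τ ⊠ τ) (2 * suc k))
      ≈⟨ S.+-congˡ {0ₛ} (S.-‿cong (signed-odd-product-at-even {τ} {τ} tanCoeff tanCoeff τ-odd τ-odd τ-at-odd τ-at-odd k)) ⟩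
    0ₛ +ₛ -ₛ (sgnₛ k *ₛ Σ (suc k) (λ j → tanCoeff j *ₛ tanCoeff (k ∸ j)))
      ≈⟨ S.+-congˡ {0ₛ} (S.-‿cong (S.*-congˡ {sgnₛ k} (Ttilde-normalised k))) ⟨
    0ₛ +ₛ -ₛ (sgnₛ k *ₛ (Ttilde (suc k) *ₛ I))
      ≈⟨ S.trans (S.+-identityˡ _) (S.trans (-‿distribˡ-* (sgnₛ k) (Ttilde (suc k) *ₛ I)) (S.sym (S.*-assoc (-ₛ sgnₛ k) (Ttilde (suc k)) I))) ⟩
    -ₛ sgnₛ k *ₛ Ttilde (suc k) *ₛ I                 ≈⟨ S.*-congʳ {I} (S.*-congʳ {Ttilde (suc k)} (sgnₛ-suc k)) ⟨
    sgnₛ (suc k) *ₛ Ttilde (suc k) *ₛ I              ∎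
    where
    I : PS
    I = qPoch⁻¹ (2 * suc k)

  P-odd : 𝕏.OddSeries P
  P-odd = oddSeries-odd _

  summand : ℕ → ℕ → PS
  summand n k = const (sgn k) ⊗ qbin (2 * n + 1) (2 * k) ⊗ negqPoch (2 * n ∸ 2 * k) ⊗ Ttilde k

  summand≈ : ∀ {n k} → k ≤ n → summand n k ≈ₛ qPoch (suc (2 * n)) *ₛ (V (2 * k) *ₛ P (suc (2 * (n ∸ k))))
  summand≈ {n} {k} k≤n = begin
    summand n k
      ≈⟨ ⊗⁴≈*ₛ (const (sgn k)) (qbin (2 * n + 1) (2 * k)) (negqPoch (2 * n ∸ 2 * k)) (Ttilde k) ⟩
    const (sgn k) *ₛ qbin (2 * n + 1) (2 * k) *ₛ negqPoch (2 * n ∸ 2 * k) *ₛ Ttilde k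
      ≡⟨ ≡.cong₂ (λ a b → const (sgn k) *ₛ qbin a (2 * k) *ₛ negqPoch b *ₛ Ttilde k) (ℕP.+-comm (2 * n) 1) (≡.sym (ℕP.*-distribˡ-∸ 2 n k)) ⟩
    const (sgn k) *ₛ qbin (suc (2 * n)) (2 * k) *ₛ N *ₛ Ttilde k
      ≈⟨ S.*-congʳ {Ttilde k} (S.*-congʳ {N} (S.*-cong (const≈constₛ (sgn k)) (S.trans (qbin≈qPascal 2k≤1+2n) (qPascal≈qPoch-quotient 2k≤1+2n)))) ⟩
    sgnₛ k *ₛ (Q *ₛ qPoch⁻¹ (suc (2 * n) ∸ 2 * k) *ₛ Iₖ) *ₛ N *ₛ Ttilde k
      ≡⟨ ≡.cong (λ m → sgnₛ k *ₛ (Q *ₛ qPoch⁻¹ m *ₛ Iₖ) *ₛ N *ₛ Ttilde k) (1+2n∸2k≡1+2[n∸k] k≤n) ⟩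
    sgnₛ k *ₛ (Q *ₛ Iᵣ *ₛ Iₖ) *ₛ N *ₛ Ttilde k
      ≈⟨ solve 6 (λ s Q Iᵣ Iₖ N T → s :* (Q :* Iᵣ :* Iₖ) :* N :* T := Q :* ((s :* T :* Iₖ) :* (N :* Iᵣ))) S.refl (sgnₛ k) Q Iᵣ Iₖ N (Ttilde k) ⟩
    Q *ₛ ((sgnₛ k *ₛ Ttilde k *ₛ Iₖ) *ₛ (N *ₛ Iᵣ))
      ≈⟨ S.*-congˡ {Q} (S.*-cong (V-at-even k) (S.reflexive (oddSeries-at-odd _ (n ∸ k)))) ⟨
    Q *ₛ (V (2 * k) *ₛ P (suc (2 * (n ∸ k))))        ∎
    where
    Q N Iₖ Iᵣ : PS
    Q = qPoch (suc (2 * n))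
    N = negqPoch (2 * (n ∸ k))
    Iₖ = qPoch⁻¹ (2 * k)
    Iᵣ = qPoch⁻¹ (suc (2 * (n ∸ k)))
    2k≤1+2n : 2 * k ≤ suc (2 * n)
    2k≤1+2n = ℕP.m≤n⇒m≤1+n (ℕP.*-monoʳ-≤ 2 k≤n)

  qPoch-*-τ-at-odd : ∀ n → qPoch (suc (2 * n)) *ₛ τ (suc (2 * n)) ≈ₛ sgnₛ n *ₛ Tq (suc (2 * n))
  qPoch-*-τ-at-odd n = begin
    Q *ₛ τ (suc (2 * n))                  ≈⟨ S.*-congˡ {Q} (τ-at-odd n) ⟩
    Q *ₛ (sgnₛ n *ₛ (T *ₛ I))             ≈⟨ solve 4 (λ Q s T I → Q :* (s :* (T :* I)) := (Q :* I) :* (s :* T)) S.refl Q (sgnₛ n) T I ⟩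
    (Q *ₛ I) *ₛ (sgnₛ n *ₛ T)             ≈⟨ S.*-congʳ {sgnₛ n *ₛ T} (qPoch-*-qPoch⁻¹ (suc (2 * n))) ⟩
    1ₛ *ₛ (sgnₛ n *ₛ T)                   ≈⟨ S.*-identityˡ _ ⟩
    sgnₛ n *ₛ T                           ∎
    where
    Q T I : PS
    Q = qPoch (suc (2 * n))
    T = Tq (suc (2 * n))
    I = qPoch⁻¹ (suc (2 * n))

open CoefficientExtraction
open QSeries
open QTangentCoefficients using (sgnₛ)
open QTangentSeries using (module 𝕏; τ; P; _⊠_)
open QTangentIdentity using ([1-τ²]⊠P≋τ)
open import Data.Nat using (suc; ≤-pred)
open import Data.Nat.Properties using (+-comm)
open import Relation.Binary.PropositionalEquality using (cong)
open import Relation.Binary.Reasoning.Setoid S.setoid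

open import Defs
open import Data.Nat using (ℕ; _+_; _*_; _∸_)

theorem4p1 : (n : ℕ) →
    sumPS (n + 1) (λ k → const (sgn k) ⊗ qbin (2 * n + 1) (2 * k)
    ⊗ negqPoch (2 * n ∸ 2 * k) ⊗ Ttilde k)
    ≈PS (const (sgn n) ⊗ Tq (2 * n + 1))
theorem4p1 n = at (begin
  sumPS (n + 1) (summand n)                                       ≈⟨ sumPS≈Σ (n + 1) (summand n) ⟩
  Σ (n + 1) (summand n)                                           ≡⟨ cong (λ m → Σ m (summand n)) (+-comm n 1) ⟩
  Σ (suc n) (summand n)                                           ≈⟨ Σ-cong (suc n) (λ k k≤n → summand≈ (≤-pred k≤n)) ⟩
  Σ (suc n) (λ k → Q *ₛ (V (2 * k) *ₛ P (suc (2 * (n ∸ k)))))     ≈⟨ *-distribˡ-Σ (suc n) Q (λ k → V (2 * k) *ₛ P (suc (2 * (n ∸ k)))) ⟨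
  Q *ₛ Σ (suc n) (λ k → V (2 * k) *ₛ P (suc (2 * (n ∸ k))))       ≈⟨ S.*-congˡ {Q} (𝕏.even*odd-at-odd {V} {P} V-even P-odd n) ⟨
  Q *ₛ (V ⊠ P) (suc (2 * n))                                      ≈⟨ S.*-congˡ {Q} (𝕏.at [1-τ²]⊠P≋τ (suc (2 * n))) ⟩
  Q *ₛ τ (suc (2 * n))                                            ≈⟨ qPoch-*-τ-at-odd n ⟩
  sgnₛ n *ₛ Tq (suc (2 * n))                                      ≡⟨ cong (λ m → sgnₛ n *ₛ Tq m) (+-comm 1 (2 * n)) ⟩
  sgnₛ n *ₛ Tq (2 * n + 1)                                        ≈⟨ const⊗≈constₛ*ₛ (sgn n) (Tq (2 * n + 1)) ⟨
  const (sgn n) ⊗ Tq (2 * n + 1)                                  ∎)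
  where
  Q : PS
  Q = qPoch (suc (2 * n))
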